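{- Over the class of all finite simple graphs, $\mathcal{E} <_{s.d.p} T$, where $\mathcal{E}$ is the Euler polynomial and $T$ the Tutte polynomial.
   Context: Graphs are finite and simple. For $A\subseteq E(G)$, $k(A)$ is the number of connected components of $(V(G),A)$. Tutte polynomial: $T(G;x,y)=\sum_{A\subseteq E(G)}(x-1)^{k(A)-k(E)}(y-1)^{k(A)+|A|-|V(G)|}$. Euler polynomial: $\mathcal{E}(G;x)=\sum x^{|A|}$ over all $A\subseteq E(G)$ such that every vertex has even degree in $(V(G),A)$. $G,H$ are similar if they have the same numbers of vertices, edges and connected components. For graph polynomials $P,Q$: $P<_{s.d.p}Q$ if for all similar graphs $G,H$, $Q(G)=Q(H)$ implies $P(G)=P(H)$. -}

module Defs where

open import Data.Nat as ℕ using (ℕ; zero; suc; _∸_; _<_)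
open import Data.Nat.Base using (_≡ᵇ_)
open import Data.Integer as ℤ using (ℤ; +_; -_)
open import Data.Fin using (Fin; toℕ)
open import Data.Fin.Properties using (_≟_)
open import Data.Vec using (Vec; []; _∷_; lookup)
open import Data.List using (List; []; _∷_; _++_; map; foldr; upTo; allFin; filter; length)
open import Data.Bool using (Bool; true; false; _∧_; _∨_; not; if_then_else_)
open import Data.Product using (_×_; _,_; proj₁; proj₂)
open import Relation.Nullary.Decidable using (⌊_⌋)
open import Relation.Binary.PropositionalEquality using (_≡_)

-- Vertices are Fin n; edges are an injectively indexed family of
-- m pairs (u , v) with u < v (so no loops, no multi-edges, and each
-- unordered edge {u,v} is stored exactly once).

record Graph : Set where
  field
    n     : ℕ
    m     : ℕ
    edges : Vec (Fin n × Fin n) m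
    noLoopOriented : ∀ i → toℕ (proj₁ (lookup edges i)) < toℕ (proj₂ (lookup edges i))
    noMulti        : ∀ i j → lookup edges i ≡ lookup edges j → i ≡ j
open Graph public

EdgeSubset : Graph → Set
EdgeSubset G = Vec Bool (m G)

allSubsets : (k : ℕ) → List (Vec Bool k)
allSubsets zero    = [] ∷ []
allSubsets (suc k) = map (false ∷_) (allSubsets k) ++ map (true ∷_) (allSubsets k)

fullSubset : (k : ℕ) → Vec Bool k
fullSubset zero    = []
fullSubset (suc k) = true ∷ fullSubset k

selected : ∀ {V : Set} {k} → Vec (V × V) k → Vec Bool k → List (V × V)
selected []       []           = []
selected (e ∷ es) (true  ∷ bs) = e ∷ selected es bs
selected (e ∷ es) (false ∷ bs) = selected es bs

card : ∀ {k} → Vec Bool k → ℕ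
card []           = 0
card (true ∷ bs)  = suc (card bs)
card (false ∷ bs) = card bs

_==_ : ∀ {n} → Fin n → Fin n → Bool
a == b = ⌊ a ≟ b ⌋

anyL : ∀ {X : Set} → (X → Bool) → List X → Bool
anyL p = foldr (λ x b → p x ∨ b) false

countL : ∀ {X : Set} → (X → Bool) → List X → ℕ
countL p = foldr (λ x c → if p x then suc c else c) 0

reach : ∀ {n} → List (Fin n × Fin n) → ℕ → Fin n → Fin n → Bool
reach es zero    u v = u == v
reach es (suc s) u v =
  reach es s u v ∨
  anyL (λ e → (reach es s u (proj₁ e) ∧ (proj₂ e == v)) ∨
              (reach es s u (proj₂ e) ∧ (proj₁ e == v))) es

-- connected in (Fin n , es): walks of length ≤ n suffice.
connected : ∀ {n} → List (Fin n × Fin n) → Fin n → Fin n → Bool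
connected {n} es = reach es n

-- number of connected components of (Fin n , es): each component is
-- counted once, via its least vertex.
components : ∀ {n} → List (Fin n × Fin n) → ℕ
components {n} es =
  countL (λ v → not (anyL (λ u → ⌊ toℕ u ℕ.<? toℕ v ⌋ ∧ connected es v u) (allFin n)))
         (allFin n)

k : (G : Graph) → EdgeSubset G → ℕ
k G A = components (selected (edges G) A)

kE : Graph → ℕ
kE G = k G (fullSubset (m G))

-- Bivariate integer polynomials, as coefficient functions:
-- P i j = coefficient of x^i y^j.

Poly2 : Set
Poly2 = ℕ → ℕ → ℤ

sumℤ : List ℤ → ℤ
sumℤ = foldr ℤ._+_ (+ 0)

0P : Poly2
0P _ _ = + 0

1P : Poly2
1P zero zero = + 1
1P _    _    = + 0

xP : Poly2
xP (suc zero) zero = + 1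
xP _          _    = + 0

yP : Poly2
yP zero (suc zero) = + 1
yP _    _          = + 0

_+P_ : Poly2 → Poly2 → Poly2
(p +P q) i j = p i j ℤ.+ q i j

_-P_ : Poly2 → Poly2 → Poly2
(p -P q) i j = p i j ℤ.- q i j

_*P_ : Poly2 → Poly2 → Poly2
(p *P q) i j =
  sumℤ (map (λ a → sumℤ (map (λ b → p a b ℤ.* q (i ∸ a) (j ∸ b)) (upTo (suc j))))
            (upTo (suc i)))

_^P_ : Poly2 → ℕ → Poly2
p ^P zero  = 1P
p ^P suc e = p *P (p ^P e)

sumP : List Poly2 → Poly2
sumP = foldr _+P_ 0P

-- Tutte polynomial:
-- T(G;x,y) = Σ_{A ⊆ E} (x-1)^{k(A)-k(E)} (y-1)^{k(A)+|A|-|V|}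
-- (both exponents are always ≥ 0, so truncated subtraction is exact).
tutte : Graph → Poly2
tutte G = sumP (map term (allSubsets (m G)))
  where
  term : EdgeSubset G → Poly2
  term A = ((xP -P 1P) ^P (k G A ∸ kE G))
        *P ((yP -P 1P) ^P ((k G A ℕ.+ card A) ∸ n G))

Poly1 : Set
Poly1 = ℕ → ℤ

monomial : ℕ → Poly1
monomial d i = if d ≡ᵇ i then + 1 else + 0

sumP1 : List Poly1 → Poly1
sumP1 = foldr (λ p q i → p i ℤ.+ q i) (λ _ → + 0)

degree : (G : Graph) → EdgeSubset G → Fin (n G) → ℕ
degree G A v = countL (λ e → (proj₁ e == v) ∨ (proj₂ e == v)) (selected (edges G) A)

isEven : ℕ → Bool
isEven zero          = true
isEven (suc zero)    = false
isEven (suc (suc r)) = isEven r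

allEvenDeg : (G : Graph) → EdgeSubset G → Bool
allEvenDeg G A = foldr (λ v b → isEven (degree G A v) ∧ b) true (allFin (n G))

euler : Graph → Poly1
euler G = sumP1 (map (λ A → monomial (card A)) (filter (λ A → allEvenDeg G A ≡? true) (allSubsets (m G))))
  where
  open import Data.Bool.Properties using () renaming (_≟_ to _≡?_)

Similar : Graph → Graph → Set
Similar G H = (n G ≡ n H) × (m G ≡ m H) × (kE G ≡ kE H)

_≈P2_ : Poly2 → Poly2 → Set
p ≈P2 q = ∀ i j → p i j ≡ q i j

_≈P1_ : Poly1 → Poly1 → Set
p ≈P1 q = ∀ i → p i ≡ q i

-- For A ⊆ E let ρ(A) = k(A) - k(E) and ν(A) = k(A) + |A| - |V|, so that
-- T(G) = Σ_A (x-1)^ρ(A) (y-1)^ν(A).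
--
-- 1. T(G) determines every sum Σ_A Ψ(ρ(A), ν(A)).  Its coefficients are
--    Σ_A c(ρ(A), i) c(ν(A), j) with c(r, i) the coefficient of tⁱ in (t-1)ʳ,
--    and the binomial transform Σ_i C(i, s) c(r, i) = [r = s] turns them
--    into the numbers of A with (ρ(A), ν(A)) = (s, t).
-- 2. 2^|V| e_d(G), for e_d the coefficient of x^d in the Euler polynomial,
--    is Σ_A of a function of |E|, d, k(A) and |A|.  Colour V with two
--    colours and give each edge the sign +1 or -1 as its ends agree or not:
--    summed over colourings, the product of the signs over B ⊆ E is
--    2^|V| [B is even].  Expanding each sign as 2[agree] - 1 leaves the
--    numbers of colourings constant on the edges of the subsets A ⊆ B,
--    which are 2^k(A).
-- 3. As k(E) ≤ k(A) ≤ |V| ≤ k(A) + |A|, the pair (k(A), |A|) is recovered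
--    from (ρ(A), ν(A)) and (|V|, |E|, k(E)); so step 2 is a sum as in
--    step 1.  Similar graphs share |V|, |E| and k(E), hence equal Tutte
--    polynomials give equal 2^|V| e_d, and the factor 2^|V| cancels.
module Submission where

open import Defs
open import Data.Nat as ℕ using (ℕ; zero; suc; _∸_; _<_; _≤_; z≤n; s≤s; _^_)
import Data.Nat.Properties as ℕP
open import Data.Nat.Combinatorics using (_C_; nCk+nC[k+1]≡[n+1]C[k+1])
open import Data.Integer as ℤ using (ℤ; +_; -_; _+_; _*_; _-_; -1ℤ)
import Data.Integer.Properties as ℤP
open import Data.Integer.Tactic.RingSolver using (solve-∀)
open import Data.Fin as Fin using (Fin; zero; suc; toℕ)
import Data.Fin.Properties as FinP
open import Data.Vec using (Vec; []; _∷_; lookup; zipWith)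
open import Data.List using (List; []; _∷_; _++_; map; foldr; filter; length; upTo; applyUpTo; allFin; tabulate)
import Data.List.Properties as LP
open import Data.List.Relation.Unary.Any using (here; there)
open import Data.List.Membership.Propositional using (_∈_)
open import Data.List.Membership.Propositional.Properties using (∈-allFin)
open import Data.Bool using (Bool; true; false; _∧_; _∨_; not; _xor_; if_then_else_)
import Data.Bool.Properties as BoolP
open import Data.Product using (Σ; _,_; _×_; proj₁; proj₂)
open import Data.Sum using (_⊎_; inj₁; inj₂)
open import Data.Empty using (⊥-elim)
open import Algebra.Bundles using (CommutativeRing)
open import Algebra.Properties.CommutativeSemigroup ℤP.+-commutativeSemigroup using ()
  renaming (interchange to +-interchange)
open import Algebra.Properties.CommutativeSemigroup ℕP.+-commutativeSemigroup using ()
  renaming (interchange to +-interchangeℕ)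
open import Algebra.Properties.CommutativeSemigroup
  (CommutativeRing.+-commutativeSemigroup BoolP.xor-∧-commutativeRing) using ()
  renaming (interchange to xor-interchange)
open import Function.Bundles using (mk⇔; Equivalence)
open import Relation.Binary.Definitions using (tri<; tri≈; tri>)
open import Relation.Nullary using (yes; no; Dec)
open import Relation.Nullary.Decidable using (⌊_⌋; toWitness; fromWitness)
open import Relation.Binary.PropositionalEquality

module FiniteSums where
  open ≡-Reasoning

  ⟦_⟧ : Bool → ℤ
  ⟦ true ⟧  = + 1
  ⟦ false ⟧ = + 0

  sumℤ-++ : ∀ (xs ys : List ℤ) → sumℤ (xs ++ ys) ≡ sumℤ xs + sumℤ ys
  sumℤ-++ []       ys = sym (ℤP.+-identityˡ _)
  sumℤ-++ (x ∷ xs) ys = trans (cong (_+_ x) (sumℤ-++ xs ys)) (sym (ℤP.+-assoc x _ _))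

  sumℤ-map-cong : ∀ {X : Set} {f g : X → ℤ} (xs : List X) → (∀ x → f x ≡ g x) →
                  sumℤ (map f xs) ≡ sumℤ (map g xs)
  sumℤ-map-cong []       f≗g = refl
  sumℤ-map-cong (x ∷ xs) f≗g = cong₂ _+_ (f≗g x) (sumℤ-map-cong xs f≗g)

  sumSubsets : (M : ℕ) → (Vec Bool M → ℤ) → ℤ
  sumSubsets zero    f = f []
  sumSubsets (suc M) f = sumSubsets M (λ A → f (false ∷ A)) + sumSubsets M (λ A → f (true ∷ A))

  sumSubsets-allSubsets : ∀ M (f : Vec Bool M → ℤ) → sumℤ (map f (allSubsets M)) ≡ sumSubsets M f
  sumSubsets-allSubsets zero    f = ℤP.+-identityʳ _
  sumSubsets-allSubsets (suc M) f = begin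
    sumℤ (map f (map (false ∷_) S ++ map (true ∷_) S))
      ≡⟨ cong sumℤ (LP.map-++ f (map (false ∷_) S) _) ⟩
    sumℤ (map f (map (false ∷_) S) ++ map f (map (true ∷_) S))
      ≡⟨ sumℤ-++ (map f (map (false ∷_) S)) _ ⟩
    sumℤ (map f (map (false ∷_) S)) + sumℤ (map f (map (true ∷_) S))
      ≡⟨ cong₂ _+_ (cong sumℤ (sym (LP.map-∘ S))) (cong sumℤ (sym (LP.map-∘ S))) ⟩
    sumℤ (map (λ A → f (false ∷ A)) S) + sumℤ (map (λ A → f (true ∷ A)) S)
      ≡⟨ cong₂ _+_ (sumSubsets-allSubsets M _) (sumSubsets-allSubsets M _) ⟩
    sumSubsets (suc M) f ∎
    where
    S : List (Vec Bool M)
    S = allSubsets M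

  sumSubsets-cong : ∀ M {f g : Vec Bool M → ℤ} → (∀ A → f A ≡ g A) → sumSubsets M f ≡ sumSubsets M g
  sumSubsets-cong zero    f≗g = f≗g []
  sumSubsets-cong (suc M) f≗g = cong₂ _+_ (sumSubsets-cong M (λ A → f≗g (false ∷ A)))
                                          (sumSubsets-cong M (λ A → f≗g (true ∷ A)))

  sumSubsets-+ : ∀ M (f g : Vec Bool M → ℤ) →
                 sumSubsets M (λ A → f A + g A) ≡ sumSubsets M f + sumSubsets M g
  sumSubsets-+ zero    f g = refl
  sumSubsets-+ (suc M) f g =
    trans (cong₂ _+_ (sumSubsets-+ M f₀ g₀) (sumSubsets-+ M f₁ g₁))
          (+-interchange (sumSubsets M f₀) (sumSubsets M g₀) (sumSubsets M f₁) (sumSubsets M g₁))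
    where
    f₀ f₁ g₀ g₁ : Vec Bool M → ℤ
    f₀ A = f (false ∷ A)
    f₁ A = f (true ∷ A)
    g₀ A = g (false ∷ A)
    g₁ A = g (true ∷ A)

  sumSubsets-scale : ∀ M c (f : Vec Bool M → ℤ) → sumSubsets M (λ A → c * f A) ≡ c * sumSubsets M f
  sumSubsets-scale zero    c f = refl
  sumSubsets-scale (suc M) c f =
    trans (cong₂ _+_ (sumSubsets-scale M c _) (sumSubsets-scale M c _)) (sym (ℤP.*-distribˡ-+ c _ _))

  sumSubsets-zero : ∀ M → sumSubsets M (λ _ → + 0) ≡ + 0
  sumSubsets-zero zero    = refl
  sumSubsets-zero (suc M) = cong₂ _+_ (sumSubsets-zero M) (sumSubsets-zero M)

  sumRange : ℕ → (ℕ → ℤ) → ℤ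
  sumRange zero    f = + 0
  sumRange (suc D) f = f 0 + sumRange D (λ i → f (suc i))

  sumRange-cong : ∀ D {f g : ℕ → ℤ} → (∀ i → f i ≡ g i) → sumRange D f ≡ sumRange D g
  sumRange-cong zero    f≗g = refl
  sumRange-cong (suc D) f≗g = cong₂ _+_ (f≗g 0) (sumRange-cong D (λ i → f≗g (suc i)))

  sumRange-+ : ∀ D (f g : ℕ → ℤ) → sumRange D (λ i → f i + g i) ≡ sumRange D f + sumRange D g
  sumRange-+ zero    f g = refl
  sumRange-+ (suc D) f g =
    trans (cong (_+_ (f 0 + g 0)) (sumRange-+ D _ _)) (+-interchange (f 0) (g 0) _ _)

  sumRange-scale : ∀ D c (f : ℕ → ℤ) → sumRange D (λ i → c * f i) ≡ c * sumRange D f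
  sumRange-scale zero    c f = sym (ℤP.*-zeroʳ c)
  sumRange-scale (suc D) c f =
    trans (cong (_+_ (c * f 0)) (sumRange-scale D c _)) (sym (ℤP.*-distribˡ-+ c _ _))

  sumRange-neg : ∀ D (f : ℕ → ℤ) → sumRange D (λ i → - f i) ≡ - sumRange D f
  sumRange-neg zero    f = refl
  sumRange-neg (suc D) f =
    trans (cong (_+_ (- f 0)) (sumRange-neg D _)) (sym (ℤP.neg-distrib-+ (f 0) _))

  sumRange-zero : ∀ D → sumRange D (λ _ → + 0) ≡ + 0
  sumRange-zero zero    = refl
  sumRange-zero (suc D) = trans (ℤP.+-identityˡ _) (sumRange-zero D)

  sumRange-sumSubsets : ∀ D M (f : ℕ → Vec Bool M → ℤ) →
    sumRange D (λ i → sumSubsets M (f i)) ≡ sumSubsets M (λ A → sumRange D (λ i → f i A))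
  sumRange-sumSubsets zero    M f = sym (sumSubsets-zero M)
  sumRange-sumSubsets (suc D) M f =
    trans (cong (_+_ (sumSubsets M (f 0))) (sumRange-sumSubsets D M _)) (sym (sumSubsets-+ M _ _))

  sumRange-delta : ∀ D r (f : ℕ → ℤ) → r < D → sumRange D (λ s → f s * ⟦ r ℕ.≡ᵇ s ⟧) ≡ f r
  sumRange-delta (suc D) zero f _ = begin
    f 0 * + 1 + sumRange D (λ s → f (suc s) * + 0)
      ≡⟨ cong₂ _+_ (ℤP.*-identityʳ (f 0))
                   (trans (sumRange-cong D (λ s → ℤP.*-zeroʳ (f (suc s)))) (sumRange-zero D)) ⟩
    f 0 + + 0 ≡⟨ ℤP.+-identityʳ _ ⟩
    f 0 ∎
  sumRange-delta (suc D) (suc r) f (s≤s r<D) = begin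
    f 0 * + 0 + sumRange D (λ s → f (suc s) * ⟦ r ℕ.≡ᵇ s ⟧)
      ≡⟨ cong₂ _+_ (ℤP.*-zeroʳ (f 0)) (sumRange-delta D r (λ s → f (suc s)) r<D) ⟩
    + 0 + f (suc r) ≡⟨ ℤP.+-identityˡ _ ⟩
    f (suc r) ∎

open FiniteSums

module PolynomialCoefficients where
  open ≡-Reasoning

  sum-vanishing : ∀ (f : ℕ → ℤ) g n → (∀ x → f (g x) ≡ + 0) → sumℤ (map f (applyUpTo g n)) ≡ + 0
  sum-vanishing f g zero    f∘g≡0 = refl
  sum-vanishing f g (suc n) f∘g≡0 =
    cong₂ _+_ (f∘g≡0 0) (sum-vanishing f (λ x → g (suc x)) n (λ x → f∘g≡0 (suc x)))

  sum-onlyFirst : ∀ (f : ℕ → ℤ) g n → (∀ x → f (g (suc x)) ≡ + 0) →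
                  sumℤ (map f (applyUpTo g (suc n))) ≡ f (g 0)
  sum-onlyFirst f g n rest≡0 =
    trans (cong (_+_ (f (g 0))) (sum-vanishing f (λ x → g (suc x)) n rest≡0)) (ℤP.+-identityʳ _)

  sum-onlyLast : ∀ (f : ℕ → ℤ) g n → (∀ a → a < n → f (g a) ≡ + 0) →
                 sumℤ (map f (applyUpTo g (suc n))) ≡ f (g n)
  sum-onlyLast f g zero    _       = ℤP.+-identityʳ _
  sum-onlyLast f g (suc n) init≡0 =
    trans (cong₂ _+_ (init≡0 0 (s≤s z≤n))
                     (sum-onlyLast f (λ x → g (suc x)) n (λ a a<n → init≡0 (suc a) (s≤s a<n))))
          (ℤP.+-identityˡ _)

  XOnly : Poly2 → Set
  XOnly p = ∀ a b → p a (suc b) ≡ + 0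

  YOnly : Poly2 → Set
  YOnly q = ∀ a b → q (suc a) b ≡ + 0

  ∸-positive : ∀ a i → a < i → Σ ℕ (λ c → i ∸ a ≡ suc c)
  ∸-positive zero    (suc i) _         = i , refl
  ∸-positive (suc a) (suc i) (s≤s a<i) = ∸-positive a i a<i

  *P-separated : ∀ p q → XOnly p → YOnly q → ∀ i j → (p *P q) i j ≡ p i 0 * q 0 j
  *P-separated p q xp yq i j = begin
    sumℤ (map (λ a → sumℤ (map (λ b → p a b * q (i ∸ a) (j ∸ b)) (upTo (suc j)))) (upTo (suc i)))
      ≡⟨ sumℤ-map-cong (upTo (suc i)) (λ a →
           sum-onlyFirst (λ b → p a b * q (i ∸ a) (j ∸ b)) (λ x → x) j (λ b →
             trans (cong (_* q (i ∸ a) (j ∸ suc b)) (xp a b)) (ℤP.*-zeroˡ (q (i ∸ a) (j ∸ suc b))))) ⟩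
    sumℤ (map (λ a → p a 0 * q (i ∸ a) j) (upTo (suc i)))
      ≡⟨ sum-onlyLast (λ a → p a 0 * q (i ∸ a) j) (λ x → x) i earlier≡0 ⟩
    p i 0 * q (i ∸ i) j
      ≡⟨ cong (λ z → p i 0 * q z j) (ℕP.n∸n≡0 i) ⟩
    p i 0 * q 0 j ∎
    where
    earlier≡0 : ∀ a → a < i → p a 0 * q (i ∸ a) j ≡ + 0
    earlier≡0 a a<i with ∸-positive a i a<i
    ... | c , i∸a≡1+c = trans (cong (λ z → p a 0 * q z j) i∸a≡1+c)
                              (trans (cong (p a 0 *_) (yq c j)) (ℤP.*-zeroʳ (p a 0)))

  XOnly-*P : ∀ p q → XOnly p → XOnly q → XOnly (p *P q)
  XOnly-*P p q xp xq a b =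
    sum-vanishing _ (λ x → x) (suc a) (λ a′ → sum-vanishing _ (λ x → x) (suc (suc b)) (term≡0 a′))
    where
    term≡0 : ∀ a′ b′ → p a′ b′ * q (a ∸ a′) (suc b ∸ b′) ≡ + 0
    term≡0 a′ zero     = trans (cong (p a′ 0 *_) (xq (a ∸ a′) b)) (ℤP.*-zeroʳ (p a′ 0))
    term≡0 a′ (suc b′) =
      trans (cong (_* q (a ∸ a′) (b ∸ b′)) (xp a′ b′)) (ℤP.*-zeroˡ (q (a ∸ a′) (b ∸ b′)))

  YOnly-*P : ∀ p q → YOnly p → YOnly q → YOnly (p *P q)
  YOnly-*P p q yp yq a b =
    sum-vanishing _ (λ x → x) (suc (suc a)) (λ a′ → sum-vanishing _ (λ x → x) (suc b) (term≡0 a′))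
    where
    term≡0 : ∀ a′ b′ → p a′ b′ * q (suc a ∸ a′) (b ∸ b′) ≡ + 0
    term≡0 zero     b′ = trans (cong (p 0 b′ *_) (yq a (b ∸ b′))) (ℤP.*-zeroʳ (p 0 b′))
    term≡0 (suc a′) b′ =
      trans (cong (_* q (a ∸ a′) (b ∸ b′)) (yp a′ b′)) (ℤP.*-zeroˡ (q (a ∸ a′) (b ∸ b′)))

  x-1 y-1 : Poly2
  x-1 = xP -P 1P
  y-1 = yP -P 1P

  XOnly-x-1^ : ∀ r → XOnly (x-1 ^P r)
  XOnly-x-1^ zero    zero          b = refl
  XOnly-x-1^ zero    (suc a)       b = refl
  XOnly-x-1^ (suc r) = XOnly-*P x-1 (x-1 ^P r) x-1-xOnly (XOnly-x-1^ r)
    where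
    x-1-xOnly : XOnly x-1
    x-1-xOnly zero          b = refl
    x-1-xOnly (suc zero)    b = refl
    x-1-xOnly (suc (suc a)) b = refl

  YOnly-y-1^ : ∀ r → YOnly (y-1 ^P r)
  YOnly-y-1^ zero    a zero    = refl
  YOnly-y-1^ zero    a (suc b) = refl
  YOnly-y-1^ (suc r) = YOnly-*P y-1 (y-1 ^P r) y-1-yOnly (YOnly-y-1^ r)
    where
    y-1-yOnly : YOnly y-1
    y-1-yOnly a zero          = refl
    y-1-yOnly a (suc zero)    = refl
    y-1-yOnly a (suc (suc b)) = refl

  -- powCoeff r i is the coefficient of tⁱ in (t - 1)ʳ, via (t - 1)ʳ⁺¹ = t (t - 1)ʳ - (t - 1)ʳ.
  powCoeff : ℕ → ℕ → ℤ
  powCoeff zero    zero    = + 1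
  powCoeff zero    (suc i) = + 0
  powCoeff (suc r) zero    = - powCoeff r 0
  powCoeff (suc r) (suc i) = powCoeff r i - powCoeff r (suc i)

  neg+shift : ∀ a b → (- a) + (b + + 0) ≡ b - a
  neg+shift = solve-∀

  powCoeff-x : ∀ r i → (x-1 ^P r) i 0 ≡ powCoeff r i
  powCoeff-x zero    zero    = refl
  powCoeff-x zero    (suc i) = refl
  powCoeff-x (suc r) zero    =
    trans (ℤP.+-identityʳ _) (trans (ℤP.+-identityʳ _)
          (trans (ℤP.-1*i≡-i ((x-1 ^P r) 0 0)) (cong -_ (powCoeff-x r 0))))
  powCoeff-x (suc r) (suc i) = begin
    (x-1 ^P suc r) (suc i) 0
      ≡⟨ cong₂ _+_ (trans (ℤP.+-identityʳ _) (ℤP.-1*i≡-i (p (suc i) 0)))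
                   (cong₂ _+_ (trans (ℤP.+-identityʳ _) (ℤP.*-identityˡ (p i 0)))
                              (sum-vanishing _ (λ x → suc (suc x)) i (λ x →
                                 trans (ℤP.+-identityʳ _) (ℤP.*-zeroˡ (p (i ∸ suc x) 0))))) ⟩
    (- p (suc i) 0) + (p i 0 + + 0)
      ≡⟨ cong₂ (λ a b → (- a) + (b + + 0)) (powCoeff-x r (suc i)) (powCoeff-x r i) ⟩
    (- powCoeff r (suc i)) + (powCoeff r i + + 0)
      ≡⟨ neg+shift (powCoeff r (suc i)) (powCoeff r i) ⟩
    powCoeff (suc r) (suc i) ∎
    where
    p : Poly2
    p = x-1 ^P r

  powCoeff-y : ∀ r j → (y-1 ^P r) 0 j ≡ powCoeff r j
  powCoeff-y zero    zero    = refl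
  powCoeff-y zero    (suc j) = refl
  powCoeff-y (suc r) zero    =
    trans (ℤP.+-identityʳ _) (trans (ℤP.+-identityʳ _)
          (trans (ℤP.-1*i≡-i ((y-1 ^P r) 0 0)) (cong -_ (powCoeff-y r 0))))
  powCoeff-y (suc r) (suc j) = begin
    (y-1 ^P suc r) 0 (suc j)
      ≡⟨ trans (ℤP.+-identityʳ _)
               (cong₂ _+_ (ℤP.-1*i≡-i (q 0 (suc j)))
                          (cong₂ _+_ (ℤP.*-identityˡ (q 0 j))
                                     (sum-vanishing _ (λ x → suc (suc x)) j (λ x →
                                        ℤP.*-zeroˡ (q 0 (j ∸ suc x)))))) ⟩
    (- q 0 (suc j)) + (q 0 j + + 0)
      ≡⟨ cong₂ (λ a b → (- a) + (b + + 0)) (powCoeff-y r (suc j)) (powCoeff-y r j) ⟩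
    (- powCoeff r (suc j)) + (powCoeff r j + + 0)
      ≡⟨ neg+shift (powCoeff r (suc j)) (powCoeff r j) ⟩
    powCoeff (suc r) (suc j) ∎
    where
    q : Poly2
    q = y-1 ^P r

  powCoeff-xy : ∀ r s i j → ((x-1 ^P r) *P (y-1 ^P s)) i j ≡ powCoeff r i * powCoeff s j
  powCoeff-xy r s i j =
    trans (*P-separated (x-1 ^P r) (y-1 ^P s) (XOnly-x-1^ r) (YOnly-y-1^ s) i j)
          (cong₂ _*_ (powCoeff-x r i) (powCoeff-y s j))

open PolynomialCoefficients

module BinomialInversion where
  open ≡-Reasoning

  -- The binomial transform Σ_{i<D} C(i,s) f(i): the coefficient of tˢ in Σ_i f(i) (t + 1)ⁱ.
  binomialTransform : ℕ → ℕ → (ℕ → ℤ) → ℤ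
  binomialTransform D s f = sumRange D (λ i → + (i C s) * f i)

  binomialTransform-pascal : ∀ D s (f : ℕ → ℤ) →
    sumRange D (λ i → + (suc i C suc s) * f i) ≡ binomialTransform D s f + binomialTransform D (suc s) f
  binomialTransform-pascal D s f = begin
    sumRange D (λ i → + (suc i C suc s) * f i)
      ≡⟨ sumRange-cong D (λ i → trans (cong (λ c → + c * f i) (sym (nCk+nC[k+1]≡[n+1]C[k+1] i s)))
                                      (trans (cong (_* f i) (ℤP.pos-+ (i C s) (i C suc s)))
                                             (ℤP.*-distribʳ-+ (f i) (+ (i C s)) (+ (i C suc s))))) ⟩
    sumRange D (λ i → + (i C s) * f i + + (i C suc s) * f i)
      ≡⟨ sumRange-+ D _ _ ⟩
    binomialTransform D s f + binomialTransform D (suc s) f ∎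

  -- Substituting t ↦ t + 1 in (t - 1)ʳ gives tʳ: the binomial transform inverts powCoeff.
  binomialTransform-powCoeff : ∀ r D → r < D → ∀ s → binomialTransform D s (powCoeff r) ≡ ⟦ r ℕ.≡ᵇ s ⟧
  binomialTransform-powCoeff zero (suc D) _ s = begin
    + (0 C s) * + 1 + sumRange D (λ i → + (suc i C s) * + 0)
      ≡⟨ cong₂ _+_ (ℤP.*-identityʳ (+ (0 C s)))
                   (trans (sumRange-cong D (λ i → ℤP.*-zeroʳ (+ (suc i C s)))) (sumRange-zero D)) ⟩
    + (0 C s) + + 0 ≡⟨ ℤP.+-identityʳ _ ⟩
    + (0 C s) ≡⟨ C-zero s ⟩
    ⟦ 0 ℕ.≡ᵇ s ⟧ ∎
    where
    C-zero : ∀ s → + (0 C s) ≡ ⟦ 0 ℕ.≡ᵇ s ⟧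
    C-zero zero    = refl
    C-zero (suc s) = refl
  binomialTransform-powCoeff (suc r) (suc D) (s≤s r<D) s = begin
    binomialTransform (suc D) s (powCoeff (suc r))
      ≡⟨ cong (_+_ (+ (0 C s) * (- c 0)))
              (trans (sumRange-cong D (λ i → ℤP.*-distribˡ-+ (+ (suc i C s)) (c i) (- c (suc i))))
                     (sumRange-+ D _ _)) ⟩
    + (0 C s) * (- c 0) + (shifted s + sumRange D (λ i → + (suc i C s) * (- c (suc i))))
      ≡⟨ cong (λ y → + (0 C s) * (- c 0) + (shifted s + y))
              (trans (sumRange-cong D (λ i → sym (ℤP.neg-distribʳ-* (+ (suc i C s)) (c (suc i)))))
                     (sumRange-neg D _)) ⟩
    + (0 C s) * (- c 0) + (shifted s + - sumRange D (λ i → + (suc i C s) * c (suc i)))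
      ≡⟨ regroup (+ (0 C s)) (c 0) (shifted s) _ ⟩
    shifted s - binomialTransform (suc D) s c
      ≡⟨ cong (_-_ (shifted s)) (binomialTransform-powCoeff r (suc D) (ℕP.m<n⇒m<1+n r<D) s) ⟩
    shifted s - ⟦ r ℕ.≡ᵇ s ⟧
      ≡⟨ shifted-minus s ⟩
    ⟦ suc r ℕ.≡ᵇ s ⟧ ∎
    where
    c : ℕ → ℤ
    c = powCoeff r
    shifted : ℕ → ℤ
    shifted s = sumRange D (λ i → + (suc i C s) * c i)
    regroup : ∀ a b x y → a * (- b) + (x + - y) ≡ x - (a * b + y)
    regroup = solve-∀
    shifted-minus : ∀ s → shifted s - ⟦ r ℕ.≡ᵇ s ⟧ ≡ ⟦ suc r ℕ.≡ᵇ s ⟧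
    shifted-minus zero = begin
      shifted 0 - ⟦ r ℕ.≡ᵇ 0 ⟧
        ≡⟨ cong (_- ⟦ r ℕ.≡ᵇ 0 ⟧) (binomialTransform-powCoeff r D r<D 0) ⟩
      ⟦ r ℕ.≡ᵇ 0 ⟧ - ⟦ r ℕ.≡ᵇ 0 ⟧ ≡⟨ ℤP.i≡j⇒i-j≡0 {⟦ r ℕ.≡ᵇ 0 ⟧} refl ⟩
      + 0 ∎
    shifted-minus (suc s) = begin
      shifted (suc s) - ⟦ r ℕ.≡ᵇ suc s ⟧
        ≡⟨ cong (_- ⟦ r ℕ.≡ᵇ suc s ⟧)
                (trans (binomialTransform-pascal D s c)
                       (cong₂ _+_ (binomialTransform-powCoeff r D r<D s)
                                  (binomialTransform-powCoeff r D r<D (suc s)))) ⟩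
      ⟦ r ℕ.≡ᵇ s ⟧ + ⟦ r ℕ.≡ᵇ suc s ⟧ - ⟦ r ℕ.≡ᵇ suc s ⟧
        ≡⟨ add-sub ⟦ r ℕ.≡ᵇ s ⟧ ⟦ r ℕ.≡ᵇ suc s ⟧ ⟩
      ⟦ r ℕ.≡ᵇ s ⟧ ∎
      where
      add-sub : ∀ a b → a + b - b ≡ a
      add-sub = solve-∀

  -- For a polynomial T, the double binomial transform
  --   Σ_{i,j<D} C(i,s) C(j,t) T_ij ,
  -- which counts the index sets with (ρ, ν) = (s, t) when T = Σ_A (x-1)^ρ(A) (y-1)^ν(A).
  rankCount : ℕ → ℕ → ℕ → Poly2 → ℤ
  rankCount D s t T = sumRange D (λ i → sumRange D (λ j → (+ (i C s) * + (j C t)) * T i j))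

  tutteTransform : ℕ → (ℕ → ℕ → ℤ) → Poly2 → ℤ
  tutteTransform D Ψ T = sumRange D (λ s → sumRange D (λ t → Ψ s t * rankCount D s t T))

  tutteTransform-cong : ∀ D Ψ {T T′} → T ≈P2 T′ → tutteTransform D Ψ T ≡ tutteTransform D Ψ T′
  tutteTransform-cong D Ψ T≈T′ =
    sumRange-cong D (λ s → sumRange-cong D (λ t → cong (Ψ s t *_)
      (sumRange-cong D (λ i → sumRange-cong D (λ j → cong ((+ (i C s) * + (j C t)) *_) (T≈T′ i j))))))

  IsRankExpansion : (M : ℕ) (ρ ν : Vec Bool M → ℕ) → Poly2 → Set
  IsRankExpansion M ρ ν T = ∀ i j → T i j ≡ sumSubsets M (λ A → powCoeff (ρ A) i * powCoeff (ν A) j)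

  module RankRecovery (M : ℕ) (ρ ν : Vec Bool M → ℕ) (D : ℕ)
                      (ρ<D : ∀ A → ρ A < D) (ν<D : ∀ A → ν A < D) where

    rankCount-counts : ∀ {T} → IsRankExpansion M ρ ν T → ∀ s t →
      rankCount D s t T ≡ sumSubsets M (λ A → ⟦ ρ A ℕ.≡ᵇ s ⟧ * ⟦ ν A ℕ.≡ᵇ t ⟧)
    rankCount-counts {T} T≡ s t = begin
      sumRange D (λ i → sumRange D (λ j → (+ (i C s) * + (j C t)) * T i j))
        ≡⟨ sumRange-cong D (λ i → sumRange-cong D (λ j →
             trans (cong (b i j *_) (T≡ i j)) (sym (sumSubsets-scale M (b i j) (λ A → term A i j))))) ⟩
      sumRange D (λ i → sumRange D (λ j → sumSubsets M (λ A → b i j * term A i j)))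
        ≡⟨ trans (sumRange-cong D (λ i → sumRange-sumSubsets D M (λ j A → b i j * term A i j)))
                 (sumRange-sumSubsets D M (λ i A → sumRange D (λ j → b i j * term A i j))) ⟩
      sumSubsets M (λ A → sumRange D (λ i → sumRange D (λ j → b i j * term A i j)))
        ≡⟨ sumSubsets-cong M (λ A → sumRange-cong D (λ i →
             trans (sumRange-cong D (λ j → regroup (+ (i C s)) (+ (j C t)) (powCoeff (ρ A) i) (powCoeff (ν A) j)))
                   (sumRange-scale D (+ (i C s) * powCoeff (ρ A) i) (λ j → + (j C t) * powCoeff (ν A) j)))) ⟩
      sumSubsets M (λ A → sumRange D (λ i → (+ (i C s) * powCoeff (ρ A) i) * bt A))
        ≡⟨ sumSubsets-cong M (λ A →
             trans (sumRange-cong D (λ i → ℤP.*-comm (+ (i C s) * powCoeff (ρ A) i) (bt A)))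
                   (trans (sumRange-scale D (bt A) (λ i → + (i C s) * powCoeff (ρ A) i))
                          (ℤP.*-comm (bt A) _))) ⟩
      sumSubsets M (λ A → binomialTransform D s (powCoeff (ρ A)) * binomialTransform D t (powCoeff (ν A)))
        ≡⟨ sumSubsets-cong M (λ A → cong₂ _*_ (binomialTransform-powCoeff (ρ A) D (ρ<D A) s)
                                                (binomialTransform-powCoeff (ν A) D (ν<D A) t)) ⟩
      sumSubsets M (λ A → ⟦ ρ A ℕ.≡ᵇ s ⟧ * ⟦ ν A ℕ.≡ᵇ t ⟧) ∎
      where
      b : ℕ → ℕ → ℤ
      b i j = + (i C s) * + (j C t)
      bt : Vec Bool M → ℤ
      bt A = binomialTransform D t (powCoeff (ν A))
      term : Vec Bool M → ℕ → ℕ → ℤ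
      term A i j = powCoeff (ρ A) i * powCoeff (ν A) j
      regroup : ∀ a b c d → (a * b) * (c * d) ≡ (a * c) * (b * d)
      regroup = solve-∀

    tutteTransform-sums : ∀ {T} → IsRankExpansion M ρ ν T → ∀ Ψ →
      tutteTransform D Ψ T ≡ sumSubsets M (λ A → Ψ (ρ A) (ν A))
    tutteTransform-sums T≡ Ψ = begin
      sumRange D (λ s → sumRange D (λ t → Ψ s t * rankCount D s t _))
        ≡⟨ sumRange-cong D (λ s → sumRange-cong D (λ t →
             trans (cong (Ψ s t *_) (rankCount-counts T≡ s t)) (sym (sumSubsets-scale M (Ψ s t) _)))) ⟩
      sumRange D (λ s → sumRange D (λ t → sumSubsets M (λ A → Ψ s t * (δρ A s * δν A t))))
        ≡⟨ trans (sumRange-cong D (λ s → sumRange-sumSubsets D M _)) (sumRange-sumSubsets D M _) ⟩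
      sumSubsets M (λ A → sumRange D (λ s → sumRange D (λ t → Ψ s t * (δρ A s * δν A t))))
        ≡⟨ sumSubsets-cong M pick ⟩
      sumSubsets M (λ A → Ψ (ρ A) (ν A)) ∎
      where
      δρ δν : Vec Bool M → ℕ → ℤ
      δρ A s = ⟦ ρ A ℕ.≡ᵇ s ⟧
      δν A t = ⟦ ν A ℕ.≡ᵇ t ⟧
      regroup : ∀ a b c → a * (b * c) ≡ b * (a * c)
      regroup = solve-∀
      pick : ∀ A → sumRange D (λ s → sumRange D (λ t → Ψ s t * (δρ A s * δν A t))) ≡ Ψ (ρ A) (ν A)
      pick A = begin
        sumRange D (λ s → sumRange D (λ t → Ψ s t * (δρ A s * δν A t)))
          ≡⟨ sumRange-cong D (λ s → trans (sumRange-cong D (λ t → regroup (Ψ s t) (δρ A s) (δν A t)))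
                                          (trans (sumRange-scale D (δρ A s) (λ t → Ψ s t * δν A t))
                                                 (ℤP.*-comm (δρ A s) _))) ⟩
        sumRange D (λ s → sumRange D (λ t → Ψ s t * δν A t) * δρ A s)
          ≡⟨ sumRange-delta D (ρ A) (λ s → sumRange D (λ t → Ψ s t * δν A t)) (ρ<D A) ⟩
        sumRange D (λ t → Ψ (ρ A) t * δν A t)
          ≡⟨ sumRange-delta D (ν A) (Ψ (ρ A)) (ν<D A) ⟩
        Ψ (ρ A) (ν A) ∎

open BinomialInversion

module BooleanFolds where
  true≢false : true ≢ false
  true≢false ()

  ∨-introʳ : ∀ a {b} → b ≡ true → a ∨ b ≡ true
  ∨-introʳ a refl = BoolP.∨-zeroʳ a

  ∨-elim : ∀ {a b} → a ∨ b ≡ true → a ≡ true ⊎ b ≡ true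
  ∨-elim {true}  _   = inj₁ refl
  ∨-elim {false} b≡t = inj₂ b≡t

  bool-ext : ∀ {a b} → (a ≡ true → b ≡ true) → (b ≡ true → a ≡ true) → a ≡ b
  bool-ext a⇒b b⇒a = BoolP.⇔→≡ {z = true} (mk⇔ a⇒b b⇒a)

  ==-refl : ∀ {N} (v : Fin N) → (v == v) ≡ true
  ==-refl v with v FinP.≟ v
  ... | yes _  = refl
  ... | no v≢v = ⊥-elim (v≢v refl)

  ==-sound : ∀ {N} {u v : Fin N} → (u == v) ≡ true → u ≡ v
  ==-sound {u = u} {v} u==v with u FinP.≟ v
  ... | yes u≡v = u≡v

  anyL-intro : ∀ {X : Set} (p : X → Bool) {x} xs → x ∈ xs → p x ≡ true → anyL p xs ≡ true
  anyL-intro p (y ∷ xs) (here refl) px = cong (_∨ anyL p xs) px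
  anyL-intro p (y ∷ xs) (there x∈) px = ∨-introʳ (p y) (anyL-intro p xs x∈ px)

  anyL-elim : ∀ {X : Set} (p : X → Bool) xs → anyL p xs ≡ true → Σ X (λ x → x ∈ xs × p x ≡ true)
  anyL-elim p (y ∷ xs) any with ∨-elim {p y} any
  ... | inj₁ py  = y , here refl , py
  ... | inj₂ any′ with anyL-elim p xs any′
  ...   | x , x∈ , px = x , there x∈ , px

  anyL-cong : ∀ {X : Set} {p q : X → Bool} xs → (∀ x → p x ≡ q x) → anyL p xs ≡ anyL q xs
  anyL-cong []       p≗q = refl
  anyL-cong (y ∷ xs) p≗q = cong₂ _∨_ (p≗q y) (anyL-cong xs p≗q)

  allL : ∀ {X : Set} → (X → Bool) → List X → Bool
  allL p = foldr (λ x b → p x ∧ b) true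

  allL-intro : ∀ {X : Set} (p : X → Bool) xs → (∀ {x} → x ∈ xs → p x ≡ true) → allL p xs ≡ true
  allL-intro p []       all = refl
  allL-intro p (y ∷ xs) all = cong₂ _∧_ (all (here refl)) (allL-intro p xs (λ x∈ → all (there x∈)))

  allL-elim : ∀ {X : Set} (p : X → Bool) xs → allL p xs ≡ true → ∀ {x} → x ∈ xs → p x ≡ true
  allL-elim p (y ∷ xs) all (here refl) = BoolP.∧-conicalˡ (p y) _ all
  allL-elim p (y ∷ xs) all (there x∈)  = allL-elim p xs (BoolP.∧-conicalʳ (p y) _ all) x∈

  allL-cong : ∀ {X : Set} (p q : X → Bool) xs → (∀ {x} → x ∈ xs → p x ≡ q x) → allL p xs ≡ allL q xs
  allL-cong p q []       p≗q = refl
  allL-cong p q (y ∷ xs) p≗q = cong₂ _∧_ (p≗q (here refl)) (allL-cong p q xs (λ x∈ → p≗q (there x∈)))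

  andFin : (N : ℕ) → (Fin N → Bool) → Bool
  andFin zero    p = true
  andFin (suc N) p = p zero ∧ andFin N (λ v → p (suc v))

  countFin : (N : ℕ) → (Fin N → Bool) → ℕ
  countFin zero    p = 0
  countFin (suc N) p = (if p zero then 1 else 0) ℕ.+ countFin N (λ v → p (suc v))

  andFin-intro : ∀ N (p : Fin N → Bool) → (∀ v → p v ≡ true) → andFin N p ≡ true
  andFin-intro zero    p all = refl
  andFin-intro (suc N) p all = cong₂ _∧_ (all zero) (andFin-intro N _ (λ v → all (suc v)))

  andFin-elim : ∀ N (p : Fin N → Bool) → andFin N p ≡ true → ∀ v → p v ≡ true
  andFin-elim (suc N) p all zero    = BoolP.∧-conicalˡ (p zero) _ all
  andFin-elim (suc N) p all (suc v) = andFin-elim N _ (BoolP.∧-conicalʳ (p zero) _ all) v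

  andFin-cong : ∀ N {p q : Fin N → Bool} → (∀ v → p v ≡ q v) → andFin N p ≡ andFin N q
  andFin-cong zero    p≗q = refl
  andFin-cong (suc N) p≗q = cong₂ _∧_ (p≗q zero) (andFin-cong N (λ v → p≗q (suc v)))

  countFin-cong : ∀ N {p q : Fin N → Bool} → (∀ v → p v ≡ q v) → countFin N p ≡ countFin N q
  countFin-cong zero    p≗q = refl
  countFin-cong (suc N) p≗q =
    cong₂ ℕ._+_ (cong (λ b → if b then 1 else 0) (p≗q zero)) (countFin-cong N (λ v → p≗q (suc v)))

  countFin-≤ : ∀ N p → countFin N p ≤ N
  countFin-≤ zero    p = z≤n
  countFin-≤ (suc N) p with p zero
  ... | true  = s≤s (countFin-≤ N _)
  ... | false = ℕP.m≤n⇒m≤1+n (countFin-≤ N _)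

  countL-allFin : ∀ N (p : Fin N → Bool) → countL p (allFin N) ≡ countFin N p
  countL-allFin N p = go N p (λ v → v)
    where
    go : ∀ N {X : Set} (p : X → Bool) (g : Fin N → X) → countL p (tabulate g) ≡ countFin N (λ v → p (g v))
    go zero    p g = refl
    go (suc N) p g with p (g zero)
    ... | true  = cong suc (go N p (λ v → g (suc v)))
    ... | false = go N p (λ v → g (suc v))

  allL-allFin : ∀ N (p : Fin N → Bool) → allL p (allFin N) ≡ andFin N p
  allL-allFin N p = go N p (λ v → v)
    where
    go : ∀ N {X : Set} (p : X → Bool) (g : Fin N → X) → allL p (tabulate g) ≡ andFin N (λ v → p (g v))
    go zero    p g = refl
    go (suc N) p g = cong (p (g zero) ∧_) (go N p (λ v → g (suc v)))


  countFin-mono : ∀ N (p q : Fin N → Bool) → (∀ v → p v ≡ true → q v ≡ true) → countFin N p ≤ countFin N q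
  countFin-mono zero    p q p⇒q = z≤n
  countFin-mono (suc N) p q p⇒q with p zero in p0 | q zero in q0
  ... | true  | false = ⊥-elim (true≢false (trans (sym (p⇒q zero p0)) q0))
  ... | true  | true  = s≤s (countFin-mono N _ _ (λ v → p⇒q (suc v)))
  ... | false | true  = ℕP.m≤n⇒m≤1+n (countFin-mono N _ _ (λ v → p⇒q (suc v)))
  ... | false | false = countFin-mono N _ _ (λ v → p⇒q (suc v))

  countFin-strict : ∀ N (p q : Fin N → Bool) → (∀ v → p v ≡ true → q v ≡ true) →
                    ∀ w → p w ≡ false → q w ≡ true → suc (countFin N p) ≤ countFin N q
  countFin-strict (suc N) p q p⇒q zero pw qw rewrite pw | qw =
    s≤s (countFin-mono N _ _ (λ v → p⇒q (suc v)))
  countFin-strict (suc N) p q p⇒q (suc w) pw qw with p zero in p0 | q zero in q0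
  ... | true  | false = ⊥-elim (true≢false (trans (sym (p⇒q zero p0)) q0))
  ... | true  | true  = s≤s (countFin-strict N _ _ (λ v → p⇒q (suc v)) w pw qw)
  ... | false | true  = ℕP.m≤n⇒m≤1+n (countFin-strict N _ _ (λ v → p⇒q (suc v)) w pw qw)
  ... | false | false = countFin-strict N _ _ (λ v → p⇒q (suc v)) w pw qw

  countFin-positive : ∀ N (p : Fin N → Bool) w → p w ≡ true → 1 ≤ countFin N p
  countFin-positive (suc N) p zero    pw rewrite pw = s≤s z≤n
  countFin-positive (suc N) p (suc w) pw with p zero
  ... | true  = s≤s z≤n
  ... | false = countFin-positive N (λ v → p (suc v)) w pw

open BooleanFolds

module Colourings where
  count : (N : ℕ) → (Vec Bool N → Bool) → ℕ
  count zero    p = if p [] then 1 else 0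
  count (suc N) p = count N (λ σ → p (false ∷ σ)) ℕ.+ count N (λ σ → p (true ∷ σ))

  count-cong : ∀ N {p q : Vec Bool N → Bool} → (∀ σ → p σ ≡ q σ) → count N p ≡ count N q
  count-cong zero    p≗q = cong (λ b → if b then 1 else 0) (p≗q [])
  count-cong (suc N) p≗q = cong₂ ℕ._+_ (count-cong N (λ σ → p≗q _)) (count-cong N (λ σ → p≗q _))

  count-none : ∀ N → count N (λ _ → false) ≡ 0
  count-none zero    = refl
  count-none (suc N) = cong₂ ℕ._+_ (count-none N) (count-none N)

  count-all : ∀ N → count N (λ _ → true) ≡ 2 ^ N
  count-all zero    = refl
  count-all (suc N) = trans (cong₂ ℕ._+_ (count-all N) (count-all N))
                            (cong (2 ^ N ℕ.+_) (sym (ℕP.+-identityʳ _)))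

  count-mono : ∀ N {p q : Vec Bool N → Bool} → (∀ σ → p σ ≡ true → q σ ≡ true) → count N p ≤ count N q
  count-mono zero {p} {q} p⇒q with p [] | q [] | p⇒q []
  ... | false | _     | _   = z≤n
  ... | true  | true  | _   = ℕP.≤-refl
  ... | true  | false | p⇒q[] with () ← p⇒q[] refl
  count-mono (suc N) p⇒q = ℕP.+-mono-≤ (count-mono N (λ σ → p⇒q _)) (count-mono N (λ σ → p⇒q _))

  count-split : ∀ N (p q : Vec Bool N → Bool) →
                count N p ≡ count N (λ σ → p σ ∧ q σ) ℕ.+ count N (λ σ → p σ ∧ not (q σ))
  count-split zero p q with p [] | q []
  ... | true  | true  = refl
  ... | true  | false = refl
  ... | false | _     = refl
  count-split (suc N) p q =
    trans (cong₂ ℕ._+_ (count-split N p₀ q₀) (count-split N p₁ q₁))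
          (+-interchangeℕ (count N (λ σ → p₀ σ ∧ q₀ σ)) (count N (λ σ → p₀ σ ∧ not (q₀ σ)))
                          (count N (λ σ → p₁ σ ∧ q₁ σ)) (count N (λ σ → p₁ σ ∧ not (q₁ σ))))
    where
    p₀ p₁ q₀ q₁ : Vec Bool N → Bool
    p₀ σ = p (false ∷ σ)
    p₁ σ = p (true ∷ σ)
    q₀ σ = q (false ∷ σ)
    q₁ σ = q (true ∷ σ)

  count-zero-or-witness : ∀ N (p : Vec Bool N → Bool) → count N p ≡ 0 ⊎ Σ (Vec Bool N) (λ σ → p σ ≡ true)
  count-zero-or-witness zero p with p [] in p[]
  ... | true  = inj₂ ([] , p[])
  ... | false = inj₁ refl
  count-zero-or-witness (suc N) p
    with count-zero-or-witness N (λ σ → p (false ∷ σ)) | count-zero-or-witness N (λ σ → p (true ∷ σ))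
  ... | inj₂ (σ , pσ) | _            = inj₂ (false ∷ σ , pσ)
  ... | inj₁ _        | inj₂ (σ , pσ) = inj₂ (true ∷ σ , pσ)
  ... | inj₁ c₀≡0     | inj₁ c₁≡0     = inj₁ (cong₂ ℕ._+_ c₀≡0 c₁≡0)

  _⊕_ : ∀ {N} → Vec Bool N → Vec Bool N → Vec Bool N
  _⊕_ = zipWith _xor_

  count-translate : ∀ N (χ : Vec Bool N) (p : Vec Bool N → Bool) → count N (λ σ → p (σ ⊕ χ)) ≡ count N p
  count-translate zero    []          p = refl
  count-translate (suc N) (false ∷ χ) p =
    cong₂ ℕ._+_ (count-translate N χ (λ σ → p (false ∷ σ))) (count-translate N χ (λ σ → p (true ∷ σ)))
  count-translate (suc N) (true ∷ χ)  p =
    trans (cong₂ ℕ._+_ (count-translate N χ (λ σ → p (true ∷ σ)))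
                       (count-translate N χ (λ σ → p (false ∷ σ))))
          (ℕP.+-comm (count N (λ σ → p (true ∷ σ))) (count N (λ σ → p (false ∷ σ))))

  lookup-⊕ : ∀ {N} (σ χ : Vec Bool N) v → lookup (σ ⊕ χ) v ≡ lookup σ v xor lookup χ v
  lookup-⊕ (a ∷ σ) (b ∷ χ) zero    = refl
  lookup-⊕ (a ∷ σ) (b ∷ χ) (suc v) = lookup-⊕ σ χ v

  sumSubsets-⟦⟧ : ∀ N (p : Vec Bool N → Bool) → sumSubsets N (λ σ → ⟦ p σ ⟧) ≡ + count N p
  sumSubsets-⟦⟧ zero p with p []
  ... | true  = refl
  ... | false = refl
  sumSubsets-⟦⟧ (suc N) p =
    trans (cong₂ ℤ._+_ (sumSubsets-⟦⟧ N _) (sumSubsets-⟦⟧ N _))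
          (ℤP.pos-+ (count N (λ σ → p (false ∷ σ))) (count N (λ σ → p (true ∷ σ))))

  Edges : ℕ → Set
  Edges N = List (Fin N × Fin N)

  cut : ∀ {N} → Vec Bool N → Fin N × Fin N → Bool
  cut σ (u , v) = lookup σ u xor lookup σ v

  constantOn : ∀ {N} → Edges N → Vec Bool N → Bool
  constantOn L σ = allL (λ e → not (cut σ e)) L

  cut-translate : ∀ {N} (σ χ : Vec Bool N) e → cut (σ ⊕ χ) e ≡ cut σ e xor cut χ e
  cut-translate σ χ (u , v) rewrite lookup-⊕ σ χ u | lookup-⊕ σ χ v =
    xor-interchange (lookup σ u) (lookup χ u) (lookup σ v) (lookup χ v)

  same-colour : ∀ {a b} → not (a xor b) ≡ true → a ≡ b
  same-colour {false} {false} _ = refl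
  same-colour {true}  {true}  _ = refl

  same-colour-refl : ∀ a → not (a xor a) ≡ true
  same-colour-refl a = cong not (BoolP.xor-same a)

  data Constraint (N : ℕ) : Set where
    free   : Constraint N
    sameAs : Fin N → Constraint N
    fixed  : Bool → Constraint N

  satisfies : ∀ {N} → Vec Bool N → Fin N → Constraint N → Bool
  satisfies σ v free       = true
  satisfies σ v (sameAs w) = not (lookup σ v xor lookup σ w)
  satisfies σ v (fixed b)  = not (lookup σ v xor b)

  isFree : ∀ {N} → Constraint N → Bool
  isFree free       = true
  isFree (sameAs _) = false
  isFree (fixed _)  = false

  Triangular : ∀ {N} → (Fin N → Constraint N) → Set
  Triangular c = ∀ v w → c v ≡ sameAs w → toℕ w < toℕ v

  solutions : ∀ N → (Fin N → Constraint N) → ℕ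
  solutions N c = count N (λ σ → andFin N (λ v → satisfies σ v (c v)))

  fixFirst : ∀ {N} → Bool → Constraint (suc N) → Constraint N
  fixFirst b free             = free
  fixFirst b (sameAs zero)    = fixed b
  fixFirst b (sameAs (suc w)) = sameAs w
  fixFirst b (fixed c)        = fixed c

  satisfies-fixFirst : ∀ {N} b (σ : Vec Bool N) v c →
                       satisfies (b ∷ σ) (suc v) c ≡ satisfies σ v (fixFirst b c)
  satisfies-fixFirst b σ v free             = refl
  satisfies-fixFirst b σ v (sameAs zero)    = refl
  satisfies-fixFirst b σ v (sameAs (suc w)) = refl
  satisfies-fixFirst b σ v (fixed c)        = refl

  isFree-fixFirst : ∀ {N} b (c : Constraint (suc N)) → isFree (fixFirst b c) ≡ isFree c
  isFree-fixFirst b free             = refl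
  isFree-fixFirst b (sameAs zero)    = refl
  isFree-fixFirst b (sameAs (suc w)) = refl
  isFree-fixFirst b (fixed c)        = refl

  triangular-fixFirst : ∀ {N} b (c : Fin (suc N) → Constraint (suc N)) → Triangular c →
                        Triangular (λ v → fixFirst b (c (suc v)))
  triangular-fixFirst b c tri v w eq with c (suc v) in cv
  ... | sameAs (suc w′) with eq
  ...   | refl = ℕP.≤-pred (tri (suc v) (suc w) cv)

  -- By induction on N: vertex 0 is free (factor 2) or fixed (factor 1),
  -- as triangularity forbids a pointer from vertex 0.
  solutions-triangular : ∀ N (c : Fin N → Constraint N) → Triangular c →
                         solutions N c ≡ 2 ^ countFin N (λ v → isFree (c v))

  solutions-rest : ∀ N (c : Fin (suc N) → Constraint (suc N)) → Triangular c → ∀ b →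
    count N (λ σ → andFin N (λ v → satisfies (b ∷ σ) (suc v) (c (suc v))))
      ≡ 2 ^ countFin N (λ v → isFree (c (suc v)))
  solutions-rest N c tri b = begin
    count N (λ σ → andFin N (λ v → satisfies (b ∷ σ) (suc v) (c (suc v))))
      ≡⟨ count-cong N (λ σ → andFin-cong N (λ v → satisfies-fixFirst b σ v (c (suc v)))) ⟩
    solutions N (λ v → fixFirst b (c (suc v)))
      ≡⟨ solutions-triangular N _ (triangular-fixFirst b c tri) ⟩
    2 ^ countFin N (λ v → isFree (fixFirst b (c (suc v))))
      ≡⟨ cong (2 ^_) (countFin-cong N (λ v → isFree-fixFirst b (c (suc v)))) ⟩
    2 ^ countFin N (λ v → isFree (c (suc v))) ∎
    where open ≡-Reasoning

  solutions-triangular zero    c tri = refl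
  solutions-triangular (suc N) c tri with c zero in c0
  ... | sameAs w with () ← tri zero w c0
  ... | free = trans (cong₂ ℕ._+_ (solutions-rest N c tri false) (solutions-rest N c tri true))
                     (cong (2 ^ rest ℕ.+_) (sym (ℕP.+-identityʳ _)))
    where
    rest : ℕ
    rest = countFin N (λ v → isFree (c (suc v)))
  ... | fixed true  = cong₂ ℕ._+_ (count-none N) (solutions-rest N c tri true)
  ... | fixed false = trans (cong₂ ℕ._+_ (solutions-rest N c tri false) (count-none N)) (ℕP.+-identityʳ _)

open Colourings

module Reachability {N : ℕ} (L : Edges N) where

  data Walk (s : ℕ) (u v : Fin N) : Set where
    walk : reach L s u v ≡ true → Walk s u v

  unwalk : ∀ {s u v} → Walk s u v → reach L s u v ≡ true
  unwalk (walk w) = w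

  Adjacent : Fin N → Fin N → Set
  Adjacent w v = (w , v) ∈ L ⊎ (v , w) ∈ L

  -- The vertices one edge away from the set f; reach L (suc s) u = reach L s u ∪ extend (reach L s u).
  extend : (Fin N → Bool) → Fin N → Bool
  extend f v = anyL (λ e → (f (proj₁ e) ∧ (proj₂ e == v)) ∨ (f (proj₂ e) ∧ (proj₁ e == v))) L

  walk-zero : ∀ {u v} → Walk 0 u v → u ≡ v
  walk-zero (walk w) = ==-sound w

  walk-refl : ∀ u → Walk 0 u u
  walk-refl u = walk (==-refl u)

  walk-weaken : ∀ {s u v} → Walk s u v → Walk (suc s) u v
  walk-weaken {s} {u} {v} (walk w) = walk (cong (_∨ extend (reach L s u) v) w)

  walk-snoc : ∀ {s u w v} → Walk s u w → Adjacent w v → Walk (suc s) u v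
  walk-snoc {s} {u} {w} {v} (walk uw) (inj₁ wv∈L) =
    walk (∨-introʳ (reach L s u v)
           (anyL-intro _ L wv∈L (cong (_∨ (reach L s u v ∧ (w == v))) (cong₂ _∧_ uw (==-refl v)))))
  walk-snoc {s} {u} {w} {v} (walk uw) (inj₂ vw∈L) =
    walk (∨-introʳ (reach L s u v)
           (anyL-intro _ L vw∈L (∨-introʳ (reach L s u v ∧ (w == v)) (cong₂ _∧_ uw (==-refl v)))))

  walk-unsnoc : ∀ {s u v} → Walk (suc s) u v → Walk s u v ⊎ Σ (Fin N) (λ w → Walk s u w × Adjacent w v)
  walk-unsnoc {s} {u} {v} (walk w) with ∨-elim {reach L s u v} w
  ... | inj₁ short = inj₁ (walk short)
  ... | inj₂ ext with anyL-elim _ L ext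
  ...   | (a , b) , ab∈L , hit with ∨-elim {reach L s u a ∧ (b == v)} hit
  ...     | inj₁ fwd with ==-sound (BoolP.∧-conicalʳ (reach L s u a) _ fwd)
  ...       | refl = inj₂ (a , walk (BoolP.∧-conicalˡ _ _ fwd) , inj₁ ab∈L)
  walk-unsnoc {s} {u} {v} (walk w) | inj₂ ext | (a , b) , ab∈L , hit | inj₂ bwd
    with ==-sound (BoolP.∧-conicalʳ (reach L s u b) _ bwd)
  ...       | refl = inj₂ (b , walk (BoolP.∧-conicalˡ _ _ bwd) , inj₂ ab∈L)

  walk-mono : ∀ {s t u v} → s ≤ t → Walk s u v → Walk t u v
  walk-mono {s} {t} {u} {v} s≤t w = subst (λ r → Walk r u v) (ℕP.m∸n+n≡m s≤t) (weakenBy (t ∸ s) w)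
    where
    weakenBy : ∀ j → Walk s u v → Walk (j ℕ.+ s) u v
    weakenBy zero    w = w
    weakenBy (suc j) w = walk-weaken (weakenBy j w)

  walk-trans : ∀ {s t u w v} → Walk s u w → Walk t w v → Walk (t ℕ.+ s) u v
  walk-trans {t = zero}  uw wv with walk-zero wv
  ... | refl = uw
  walk-trans {t = suc t} uw wv with walk-unsnoc wv
  ... | inj₁ wv′             = walk-weaken (walk-trans uw wv′)
  ... | inj₂ (x , wx , x~v) = walk-snoc (walk-trans uw wx) x~v

  walk-sym : ∀ {s u v} → Walk s u v → Walk s v u
  walk-sym {zero}  uv with walk-zero uv
  ... | refl = uv
  walk-sym {suc s} {u} {v} uv with walk-unsnoc uv
  ... | inj₁ uv′            = walk-weaken (walk-sym uv′)
  ... | inj₂ (w , uw , w~v) =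
    subst (λ r → Walk r v u) (ℕP.+-comm s 1) (walk-trans (walk-snoc (walk-refl _) (flip w~v)) (walk-sym uw))
    where
    flip : ∀ {a b} → Adjacent a b → Adjacent b a
    flip (inj₁ ab∈L) = inj₂ ab∈L
    flip (inj₂ ba∈L) = inj₁ ba∈L

  walk-colour : ∀ (σ : Vec Bool N) → constantOn L σ ≡ true → ∀ {s u v} → Walk s u v → lookup σ u ≡ lookup σ v
  walk-colour σ const {zero} uv with walk-zero uv
  ... | refl = refl
  walk-colour σ const {suc s} uv with walk-unsnoc uv
  ... | inj₁ uv′                  = walk-colour σ const uv′
  ... | inj₂ (w , uw , inj₁ wv∈L) =
    trans (walk-colour σ const uw) (same-colour (allL-elim _ L const wv∈L))
  ... | inj₂ (w , uw , inj₂ vw∈L) =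
    trans (walk-colour σ const uw) (sym (same-colour (allL-elim _ L const vw∈L)))

  -- The sets of vertices reachable from u by walks of length ≤ s grow until
  -- they stabilise, which happens within N steps; so walks of length N suffice.
  module Saturation (u : Fin N) where

    reachable : ℕ → Fin N → Bool
    reachable s = reach L s u

    Stable : ℕ → Set
    Stable t = ∀ v → reachable (suc t) v ≡ reachable t v

    step-cong : ∀ {f g : Fin N → Bool} → (∀ x → f x ≡ g x) → ∀ v → (f v ∨ extend f v) ≡ (g v ∨ extend g v)
    step-cong f≗g v = cong₂ _∨_ (f≗g v) (anyL-cong L (λ e →
      cong₂ _∨_ (cong (_∧ (proj₂ e == v)) (f≗g (proj₁ e))) (cong (_∧ (proj₁ e == v)) (f≗g (proj₂ e)))))

    stable-forever : ∀ t → Stable t → ∀ j v → reachable (j ℕ.+ t) v ≡ reachable t v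
    stable-forever t stable zero    v = refl
    stable-forever t stable (suc j) v = trans (step-cong (stable-forever t stable j) v) (stable v)

    stable? : ∀ t → Dec (Stable t)
    stable? t = FinP.all? (λ v → reachable (suc t) v BoolP.≟ reachable t v)

    growth : ∀ s → Σ ℕ (λ t → t ≤ s × Stable t) ⊎ suc s ≤ countFin N (reachable s)
    growth zero = inj₂ (countFin-positive N (reachable 0) u (==-refl u))
    growth (suc s) with growth s
    ... | inj₁ (t , t≤s , stable) = inj₁ (t , ℕP.m≤n⇒m≤1+n t≤s , stable)
    ... | inj₂ big with stable? s
    ...   | yes stable = inj₁ (s , ℕP.n≤1+n s , stable)
    ...   | no unstable with FinP.¬∀⟶∃¬ N _ (λ v → reachable (suc s) v BoolP.≟ reachable s v) unstable
    ...     | w , changed = inj₂ (ℕP.≤-trans (s≤s big)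
               (countFin-strict N (reachable s) (reachable (suc s))
                 (λ v r → unwalk (walk-weaken (walk {s} {u} {v} r))) w old new))
      where
      old : reachable s w ≡ false
      old = BoolP.¬-not (λ r → changed (trans (unwalk (walk-weaken (walk {s} {u} {w} r))) (sym r)))
      new : reachable (suc s) w ≡ true
      new = BoolP.¬-not (λ r → changed (trans r (sym old)))

    stable-within-N : Σ ℕ (λ t → t ≤ N × Stable t)
    stable-within-N with growth N
    ... | inj₁ found = found
    ... | inj₂ big   = ⊥-elim (ℕP.<⇒≱ big (countFin-≤ N (reachable N)))

    walk-shorten : ∀ {s v} → Walk s u v → Walk N u v
    walk-shorten {s} {v} w with stable-within-N
    ... | t , t≤N , stable with s ℕP.≤? N
    ...   | yes s≤N = walk-mono s≤N w
    ...   | no  s≰N = walk-mono t≤N (walk (trans (sym (stable-forever t stable (s ∸ t) v))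
                                                 (unwalk (subst (λ r → Walk r u v) (sym (ℕP.m∸n+n≡m t≤s)) w))))
      where
      t≤s : t ≤ s
      t≤s = ℕP.≤-trans t≤N (ℕP.<⇒≤ (ℕP.≰⇒> s≰N))

  Connected : Fin N → Fin N → Set
  Connected = Walk N

  connected-walk : ∀ {s u v} → Walk s u v → Connected u v
  connected-walk {u = u} = Saturation.walk-shorten u

  connected-refl : ∀ u → Connected u u
  connected-refl u = connected-walk (walk-refl u)

  connected-sym : ∀ {u v} → Connected u v → Connected v u
  connected-sym = walk-sym

  connected-trans : ∀ {u w v} → Connected u w → Connected w v → Connected u v
  connected-trans uw wv = connected-walk (walk-trans uw wv)

  connected-edge : ∀ {u v} → (u , v) ∈ L → Connected u v
  connected-edge uv∈L = connected-walk (walk-snoc (walk-refl _) (inj₁ uv∈L))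

-- Each component has a least vertex, its leader; Defs.components counts
-- the leaders, and a colouring is constant on the edges iff every vertex
-- has the colour of an earlier vertex of its component or is a leader.
module Components {N : ℕ} (L : Edges N) where
  open Reachability L

  isLeader : Fin N → Bool
  isLeader v = not (anyL (λ u → ⌊ toℕ u ℕ.<? toℕ v ⌋ ∧ connected L v u) (allFin N))

  components≡countLeaders : components L ≡ countFin N isLeader
  components≡countLeaders = countL-allFin N isLeader

  <-sound : ∀ {a b} → ⌊ a ℕ.<? b ⌋ ≡ true → a < b
  <-sound a<b = toWitness (Equivalence.from BoolP.T-≡ a<b)

  <-complete : ∀ {a b} → a < b → ⌊ a ℕ.<? b ⌋ ≡ true
  <-complete a<b = Equivalence.to BoolP.T-≡ (fromWitness a<b)

  not-leader : ∀ {u v} → toℕ u < toℕ v → Connected v u → isLeader v ≡ false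
  not-leader {u} u<v vu = cong not (anyL-intro _ (allFin N) (∈-allFin u) (cong₂ _∧_ (<-complete u<v) (unwalk vu)))

  data LeaderView (v : Fin N) : Set where
    leader   : isLeader v ≡ true → LeaderView v
    follower : ∀ u → toℕ u < toℕ v → Connected v u → LeaderView v

  leaderView : ∀ v → LeaderView v
  leaderView v with isLeader v in isL
  ... | true  = leader isL
  ... | false with anyL-elim _ (allFin N) (BoolP.not-injective isL)
  ...   | u , _ , hit = follower u (<-sound (BoolP.∧-conicalˡ _ _ hit)) (walk (BoolP.∧-conicalʳ _ _ hit))

  leaders-unique : ∀ {a b} → isLeader a ≡ true → isLeader b ≡ true → Connected a b → a ≡ b
  leaders-unique {a} {b} isLa isLb ab with ℕP.<-cmp (toℕ a) (toℕ b)
  ... | tri< a<b _ _ = ⊥-elim (true≢false (trans (sym isLb) (not-leader a<b (connected-sym ab))))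
  ... | tri≈ _ a≡b _ = FinP.toℕ-injective a≡b
  ... | tri> _ _ b<a = ⊥-elim (true≢false (trans (sym isLa) (not-leader b<a ab)))

  constraint : Fin N → Constraint N
  constraint v with leaderView v
  ... | leader _       = free
  ... | follower u _ _ = sameAs u

  constraint-triangular : Triangular constraint
  constraint-triangular v w eq with leaderView v
  constraint-triangular v w refl | follower u u<v _ = u<v

  isFree-constraint : ∀ v → isFree (constraint v) ≡ isLeader v
  isFree-constraint v with leaderView v
  ... | leader isL        = sym isL
  ... | follower u u<v vu = sym (not-leader u<v vu)

  Solution : Vec Bool N → Set
  Solution σ = ∀ v → satisfies σ v (constraint v) ≡ true

  chase : ∀ σ → Solution σ → ∀ b v → toℕ v < b →
          Σ (Fin N) λ ℓ → isLeader ℓ ≡ true × Connected v ℓ × lookup σ v ≡ lookup σ ℓ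
  chase σ sol (suc b) v v<b with leaderView v | sol v
  ... | leader isL        | _   = v , isL , connected-refl v , refl
  ... | follower u u<v vu | σvu with chase σ sol b u (ℕP.<-≤-trans u<v (ℕP.≤-pred v<b))
  ...   | ℓ , isL , uℓ , σuℓ = ℓ , isL , connected-trans vu uℓ , trans (same-colour σvu) σuℓ

  constantOn⇒solution : ∀ σ → constantOn L σ ≡ true → Solution σ
  constantOn⇒solution σ const v with leaderView v
  ... | leader _        = refl
  ... | follower u _ vu =
    subst (λ c → not (lookup σ v xor c) ≡ true) (walk-colour σ const vu) (same-colour-refl (lookup σ v))

  solution⇒constantOn : ∀ σ → Solution σ → constantOn L σ ≡ true
  solution⇒constantOn σ sol = allL-intro _ L edge-uncut
    where
    edge-uncut : ∀ {e} → e ∈ L → not (cut σ e) ≡ true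
    edge-uncut {a , b} ab∈L with chase σ sol (suc (toℕ a)) a ℕP.≤-refl | chase σ sol (suc (toℕ b)) b ℕP.≤-refl
    ... | ℓa , isLa , aℓa , σa≡ | ℓb , isLb , bℓb , σb≡ =
      subst (λ c → not (lookup σ a xor c) ≡ true) σa≡σb (same-colour-refl (lookup σ a))
      where
      ℓa≡ℓb : ℓa ≡ ℓb
      ℓa≡ℓb = leaders-unique isLa isLb
                (connected-trans (connected-sym aℓa) (connected-trans (connected-edge ab∈L) bℓb))
      σa≡σb : lookup σ a ≡ lookup σ b
      σa≡σb = trans σa≡ (trans (cong (lookup σ) ℓa≡ℓb) (sym σb≡))

  constantOn≡solution : ∀ σ → constantOn L σ ≡ andFin N (λ v → satisfies σ v (constraint v))
  constantOn≡solution σ = bool-ext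
    (λ const → andFin-intro N _ (constantOn⇒solution σ const))
    (λ sol → solution⇒constantOn σ (andFin-elim N _ sol))

  count-constantOn : count N (constantOn L) ≡ 2 ^ components L
  count-constantOn = begin
    count N (constantOn L)                          ≡⟨ count-cong N constantOn≡solution ⟩
    solutions N constraint                          ≡⟨ solutions-triangular N constraint constraint-triangular ⟩
    2 ^ countFin N (λ v → isFree (constraint v))    ≡⟨ cong (2 ^_) (countFin-cong N isFree-constraint) ⟩
    2 ^ countFin N isLeader                         ≡⟨ cong (2 ^_) (sym components≡countLeaders) ⟩
    2 ^ components L ∎
    where open ≡-Reasoning

  components-≤ : components L ≤ N
  components-≤ = subst (_≤ N) (sym components≡countLeaders) (countFin-≤ N isLeader)

open Components using (count-constantOn; components-≤)

-- The rank inequality N ≤ #components + |L|, by counting: adding an edge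
-- at most halves the number of colourings constant on the edges.
module RankInequality where
  -- Translating by a colouring χ that is constant on L but cuts e exchanges the
  -- colourings (constant on L) that cut e with those that do not.
  count-constantOn-cons : ∀ {N} (L : Edges N) e → count N (constantOn L) ≤ 2 ℕ.* count N (constantOn (e ∷ L))
  count-constantOn-cons {N} L e = begin
    count N (constantOn L)                    ≡⟨ count-split N (constantOn L) (λ σ → cut σ e) ⟩
    cutting ℕ.+ uncut                         ≤⟨ ℕP.+-monoˡ-≤ uncut cutting≤uncut ⟩
    uncut ℕ.+ uncut                           ≡⟨ cong (uncut ℕ.+_) (sym (ℕP.+-identityʳ uncut)) ⟩
    2 ℕ.* uncut
      ≡⟨ cong (2 ℕ.*_) (count-cong N (λ σ → BoolP.∧-comm (constantOn L σ) _)) ⟩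
    2 ℕ.* count N (constantOn (e ∷ L)) ∎
    where
    open ℕP.≤-Reasoning
    cutting : ℕ
    cutting = count N (λ σ → constantOn L σ ∧ cut σ e)
    uncut : ℕ
    uncut = count N (λ σ → constantOn L σ ∧ not (cut σ e))
    cutting≤uncut : cutting ≤ uncut
    cutting≤uncut with count-zero-or-witness N (λ σ → constantOn L σ ∧ cut σ e)
    ... | inj₁ none          = subst (_≤ uncut) (sym none) z≤n
    ... | inj₂ (χ , χ-cuts) = ℕP.≤-reflexive (trans (sym (count-translate N χ _)) (count-cong N exchange))
      where
      χ-const : ∀ {e′} → e′ ∈ L → cut χ e′ ≡ false
      χ-const e′∈L = BoolP.not-injective (allL-elim _ L (BoolP.∧-conicalˡ _ _ χ-cuts) e′∈L)
      exchange : ∀ σ → (constantOn L (σ ⊕ χ) ∧ cut (σ ⊕ χ) e) ≡ (constantOn L σ ∧ not (cut σ e))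
      exchange σ = cong₂ _∧_
        (allL-cong _ _ L (λ {e′} e′∈L →
           cong not (trans (cut-translate σ χ e′)
                           (trans (cong (cut σ e′ xor_) (χ-const e′∈L)) (BoolP.xor-identityʳ _)))))
        (trans (cut-translate σ χ e)
               (trans (cong (cut σ e xor_) (BoolP.∧-conicalʳ _ _ χ-cuts)) (BoolP.xor-comm _ true)))

  count-constantOn-lower : ∀ {N} (L : Edges N) → 2 ^ N ≤ count N (constantOn L) ℕ.* 2 ^ length L
  count-constantOn-lower {N} []      = ℕP.≤-reflexive (trans (sym (count-all N)) (sym (ℕP.*-identityʳ _)))
  count-constantOn-lower {N} (e ∷ L) = begin
    2 ^ N                                            ≤⟨ count-constantOn-lower L ⟩
    count N (constantOn L) ℕ.* 2 ^ length L          ≤⟨ ℕP.*-monoˡ-≤ (2 ^ length L) (count-constantOn-cons L e) ⟩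
    (2 ℕ.* count N (constantOn (e ∷ L))) ℕ.* 2 ^ length L
      ≡⟨ trans (cong (ℕ._* 2 ^ length L) (ℕP.*-comm 2 c)) (ℕP.*-assoc c 2 (2 ^ length L)) ⟩
    c ℕ.* 2 ^ length (e ∷ L) ∎
    where
    open ℕP.≤-Reasoning
    c : ℕ
    c = count N (constantOn (e ∷ L))

  2^-cancel-≤ : ∀ a b → 2 ^ a ≤ 2 ^ b → a ≤ b
  2^-cancel-≤ a b 2^a≤2^b = ℕP.≮⇒≥ (λ b<a → ℕP.<⇒≱ (ℕP.^-monoʳ-< 2 (s≤s (s≤s z≤n)) b<a) 2^a≤2^b)

  rank-inequality : ∀ {N} (L : Edges N) → N ≤ components L ℕ.+ length L
  rank-inequality {N} L = 2^-cancel-≤ N _ (subst (2 ^ N ≤_) count≡ (count-constantOn-lower L))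
    where
    count≡ : count N (constantOn L) ℕ.* 2 ^ length L ≡ 2 ^ (components L ℕ.+ length L)
    count≡ = trans (cong (ℕ._* 2 ^ length L) (count-constantOn L))
                   (sym (ℕP.^-distribˡ-+-* 2 (components L) (length L)))

open RankInequality

module InclusionExclusion where
  open ≡-Reasoning

  sumSubsetsOf : ∀ {M} → Vec Bool M → (Vec Bool M → ℤ) → ℤ
  sumSubsetsOf []          f = f []
  sumSubsetsOf (false ∷ B) f = sumSubsetsOf B (λ A → f (false ∷ A))
  sumSubsetsOf (true ∷ B)  f = sumSubsetsOf B (λ A → f (false ∷ A)) + sumSubsetsOf B (λ A → f (true ∷ A))

  sumSupersetsOf : ∀ {M} → Vec Bool M → (Vec Bool M → ℤ) → ℤ
  sumSupersetsOf []          f = f []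
  sumSupersetsOf (false ∷ A) f = sumSupersetsOf A (λ B → f (false ∷ B)) + sumSupersetsOf A (λ B → f (true ∷ B))
  sumSupersetsOf (true ∷ A)  f = sumSupersetsOf A (λ B → f (true ∷ B))

  sumSubsetsOf-cong : ∀ {M} (B : Vec Bool M) {f g : Vec Bool M → ℤ} → (∀ A → f A ≡ g A) →
                      sumSubsetsOf B f ≡ sumSubsetsOf B g
  sumSubsetsOf-cong []          f≗g = f≗g []
  sumSubsetsOf-cong (false ∷ B) f≗g = sumSubsetsOf-cong B (λ A → f≗g _)
  sumSubsetsOf-cong (true ∷ B)  f≗g =
    cong₂ _+_ (sumSubsetsOf-cong B (λ A → f≗g _)) (sumSubsetsOf-cong B (λ A → f≗g _))

  sumSupersetsOf-cong : ∀ {M} (A : Vec Bool M) {f g : Vec Bool M → ℤ} → (∀ B → f B ≡ g B) →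
                        sumSupersetsOf A f ≡ sumSupersetsOf A g
  sumSupersetsOf-cong []          f≗g = f≗g []
  sumSupersetsOf-cong (false ∷ A) f≗g =
    cong₂ _+_ (sumSupersetsOf-cong A (λ B → f≗g _)) (sumSupersetsOf-cong A (λ B → f≗g _))
  sumSupersetsOf-cong (true ∷ A)  f≗g = sumSupersetsOf-cong A (λ B → f≗g _)

  sumSubsetsOf-scale : ∀ {M} (B : Vec Bool M) c (f : Vec Bool M → ℤ) →
                       sumSubsetsOf B (λ A → c * f A) ≡ c * sumSubsetsOf B f
  sumSubsetsOf-scale []          c f = refl
  sumSubsetsOf-scale (false ∷ B) c f = sumSubsetsOf-scale B c _
  sumSubsetsOf-scale (true ∷ B)  c f =
    trans (cong₂ _+_ (sumSubsetsOf-scale B c _) (sumSubsetsOf-scale B c _)) (sym (ℤP.*-distribˡ-+ c _ _))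

  sumSupersetsOf-scale : ∀ {M} (A : Vec Bool M) c (f : Vec Bool M → ℤ) →
                         sumSupersetsOf A (λ B → c * f B) ≡ c * sumSupersetsOf A f
  sumSupersetsOf-scale []          c f = refl
  sumSupersetsOf-scale (false ∷ A) c f =
    trans (cong₂ _+_ (sumSupersetsOf-scale A c _) (sumSupersetsOf-scale A c _)) (sym (ℤP.*-distribˡ-+ c _ _))
  sumSupersetsOf-scale (true ∷ A)  c f = sumSupersetsOf-scale A c _

  sumSubsets-sumSubsetsOf : ∀ N {M} (B : Vec Bool M) (f : Vec Bool N → Vec Bool M → ℤ) →
    sumSubsets N (λ σ → sumSubsetsOf B (f σ)) ≡ sumSubsetsOf B (λ A → sumSubsets N (λ σ → f σ A))
  sumSubsets-sumSubsetsOf N []          f = refl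
  sumSubsets-sumSubsetsOf N (false ∷ B) f = sumSubsets-sumSubsetsOf N B _
  sumSubsets-sumSubsetsOf N (true ∷ B)  f =
    trans (sumSubsets-+ N _ _) (cong₂ _+_ (sumSubsets-sumSubsetsOf N B _) (sumSubsets-sumSubsetsOf N B _))

  sum-subsets-supersets : ∀ M (g : Vec Bool M → Vec Bool M → ℤ) →
    sumSubsets M (λ B → sumSubsetsOf B (λ A → g A B)) ≡ sumSubsets M (λ A → sumSupersetsOf A (λ B → g A B))
  sum-subsets-supersets zero    g = refl
  sum-subsets-supersets (suc M) g = begin
    S₀₀ + sumSubsets M (λ B → sumSubsetsOf B (g₀₁ B) + sumSubsetsOf B (g₁₁ B))
      ≡⟨ cong (_+_ S₀₀) (sumSubsets-+ M _ _) ⟩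
    S₀₀ + (S₀₁ + S₁₁)
      ≡⟨ sym (ℤP.+-assoc S₀₀ S₀₁ S₁₁) ⟩
    (S₀₀ + S₀₁) + S₁₁
      ≡⟨ cong₂ _+_ (trans (cong₂ _+_ (sum-subsets-supersets M (λ A B → g₀₀ B A))
                                     (sum-subsets-supersets M (λ A B → g₀₁ B A)))
                          (sym (sumSubsets-+ M _ _)))
                   (sum-subsets-supersets M (λ A B → g₁₁ B A)) ⟩
    sumSubsets M (λ A → sumSupersetsOf A (λ B → g₀₀ B A) + sumSupersetsOf A (λ B → g₀₁ B A))
      + sumSubsets M (λ A → sumSupersetsOf A (λ B → g₁₁ B A)) ∎
    where
    g₀₀ g₀₁ g₁₁ : Vec Bool M → Vec Bool M → ℤ
    g₀₀ B A = g (false ∷ A) (false ∷ B)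
    g₀₁ B A = g (false ∷ A) (true ∷ B)
    g₁₁ B A = g (true ∷ A) (true ∷ B)
    S₀₀ : ℤ
    S₀₀ = sumSubsets M (λ B → sumSubsetsOf B (g₀₀ B))
    S₀₁ : ℤ
    S₀₁ = sumSubsets M (λ B → sumSubsetsOf B (g₀₁ B))
    S₁₁ : ℤ
    S₁₁ = sumSubsets M (λ B → sumSubsetsOf B (g₁₁ B))

  -- binomialSum K h = Σ_j C(K, j) h(j), by Pascal's recursion.
  binomialSum : ℕ → (ℕ → ℤ) → ℤ
  binomialSum zero    h = h 0
  binomialSum (suc K) h = binomialSum K h + binomialSum K (λ j → h (suc j))

  binomialSum-cong : ∀ K {h h′ : ℕ → ℤ} → (∀ j → h j ≡ h′ j) → binomialSum K h ≡ binomialSum K h′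
  binomialSum-cong zero    h≗h′ = h≗h′ 0
  binomialSum-cong (suc K) h≗h′ = cong₂ _+_ (binomialSum-cong K h≗h′) (binomialSum-cong K (λ j → h≗h′ (suc j)))

  card-≤ : ∀ {M} (A : Vec Bool M) → card A ≤ M
  card-≤ []          = z≤n
  card-≤ (true ∷ A)  = s≤s (card-≤ A)
  card-≤ (false ∷ A) = ℕP.m≤n⇒m≤1+n (card-≤ A)

  sumSupersetsOf-card : ∀ {M} (A : Vec Bool M) (h : ℕ → ℤ) →
    sumSupersetsOf A (λ B → h (card B)) ≡ binomialSum (M ∸ card A) (λ j → h (card A ℕ.+ j))
  sumSupersetsOf-card [] h = refl
  sumSupersetsOf-card {suc M} (false ∷ A) h = begin
    sumSupersetsOf A (λ B → h (card B)) + sumSupersetsOf A (λ B → h (suc (card B)))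
      ≡⟨ cong₂ _+_ (sumSupersetsOf-card A h) (sumSupersetsOf-card A (λ b → h (suc b))) ⟩
    binomialSum (M ∸ a) (λ j → h (a ℕ.+ j)) + binomialSum (M ∸ a) (λ j → h (suc (a ℕ.+ j)))
      ≡⟨ cong (_+_ (binomialSum (M ∸ a) (λ j → h (a ℕ.+ j))))
              (binomialSum-cong (M ∸ a) (λ j → cong h (sym (ℕP.+-suc a j)))) ⟩
    binomialSum (suc (M ∸ a)) (λ j → h (a ℕ.+ j))
      ≡⟨ cong (λ K → binomialSum K (λ j → h (a ℕ.+ j))) (sym (ℕP.+-∸-assoc 1 (card-≤ A))) ⟩
    binomialSum (suc M ∸ a) (λ j → h (a ℕ.+ j)) ∎
    where
    a : ℕ
    a = card A
  sumSupersetsOf-card {suc M} (true ∷ A) h = sumSupersetsOf-card A (λ b → h (suc b))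

  sign : Bool → ℤ
  sign false = + 1
  sign true  = - + 1

  sign≡ : ∀ c → sign c ≡ - + 1 + + 2 * ⟦ not c ⟧
  sign≡ false = refl
  sign≡ true  = refl

  cutProduct : ∀ {N} → Vec Bool N → Edges N → ℤ
  cutProduct σ = foldr (λ e z → sign (cut σ e) * z) (+ 1)

  -- (-1)^(|B| - |A|) 2^|A|, written with |A| + |B| in the exponent.
  weight : ℕ → ℕ → ℤ
  weight a b = -1ℤ ℤ.^ (a ℕ.+ b) * + (2 ^ a)

  weight-sucʳ : ∀ a b → weight a (suc b) ≡ - weight a b
  weight-sucʳ a b = begin
    -1ℤ ℤ.^ (a ℕ.+ suc b) * + (2 ^ a) ≡⟨ cong (λ z → -1ℤ ℤ.^ z * + (2 ^ a)) (ℕP.+-suc a b) ⟩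
    -1ℤ * -1ℤ ℤ.^ (a ℕ.+ b) * + (2 ^ a) ≡⟨ neg-assoc (-1ℤ ℤ.^ (a ℕ.+ b)) (+ (2 ^ a)) ⟩
    - weight a b ∎
    where
    neg-assoc : ∀ s t → -1ℤ * s * t ≡ - (s * t)
    neg-assoc = solve-∀

  weight-suc : ∀ a b → weight (suc a) (suc b) ≡ + 2 * weight a b
  weight-suc a b = begin
    -1ℤ ℤ.^ suc (a ℕ.+ suc b) * + (2 ℕ.* 2 ^ a)
      ≡⟨ cong₂ (λ z t → -1ℤ ℤ.^ suc z * t) (ℕP.+-suc a b) (ℤP.pos-* 2 (2 ^ a)) ⟩
    -1ℤ * (-1ℤ * -1ℤ ℤ.^ (a ℕ.+ b)) * (+ 2 * + (2 ^ a))
      ≡⟨ regroup (-1ℤ ℤ.^ (a ℕ.+ b)) (+ (2 ^ a)) ⟩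
    + 2 * weight a b ∎
    where
    regroup : ∀ s t → -1ℤ * (-1ℤ * s) * (+ 2 * t) ≡ + 2 * (s * t)
    regroup = solve-∀

  ⟦∧⟧ : ∀ a b → ⟦ a ∧ b ⟧ ≡ ⟦ a ⟧ * ⟦ b ⟧
  ⟦∧⟧ true  b = sym (ℤP.*-identityˡ ⟦ b ⟧)
  ⟦∧⟧ false b = sym (ℤP.*-zeroˡ ⟦ b ⟧)

  inclusion-exclusion : ∀ {N M} (es : Vec (Fin N × Fin N) M) (B : Vec Bool M) (σ : Vec Bool N) →
    sumSubsetsOf B (λ A → weight (card A) (card B) * ⟦ constantOn (selected es A) σ ⟧)
      ≡ cutProduct σ (selected es B)
  inclusion-exclusion []       []          σ = refl
  inclusion-exclusion (e ∷ es) (false ∷ B) σ = inclusion-exclusion es B σ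
  inclusion-exclusion (e ∷ es) (true ∷ B)  σ = begin
    sumSubsetsOf B (λ A → weight (card A) (suc (card B)) * ⟦ c A ⟧)
      + sumSubsetsOf B (λ A → weight (suc (card A)) (suc (card B)) * ⟦ not (cut σ e) ∧ c A ⟧)
      ≡⟨ cong₂ _+_ (sumSubsetsOf-cong B (λ A → trans (cong (_* ⟦ c A ⟧) (weight-sucʳ (card A) (card B)))
                                                     (neg-out (weight (card A) (card B)) ⟦ c A ⟧)))
                   (sumSubsetsOf-cong B (λ A →
                      trans (cong₂ _*_ (weight-suc (card A) (card B)) (⟦∧⟧ (not (cut σ e)) (c A)))
                            (swap (weight (card A) (card B)) u ⟦ c A ⟧))) ⟩
    sumSubsetsOf B (λ A → - + 1 * term A) + sumSubsetsOf B (λ A → (+ 2 * u) * term A)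
      ≡⟨ cong₂ _+_ (sumSubsetsOf-scale B (- + 1) term) (sumSubsetsOf-scale B (+ 2 * u) term) ⟩
    - + 1 * S + (+ 2 * u) * S
      ≡⟨ sym (ℤP.*-distribʳ-+ S (- + 1) (+ 2 * u)) ⟩
    (- + 1 + + 2 * u) * S
      ≡⟨ cong₂ _*_ (sym (sign≡ (cut σ e))) (inclusion-exclusion es B σ) ⟩
    sign (cut σ e) * cutProduct σ (selected es B) ∎
    where
    c : Vec Bool _ → Bool
    c A = constantOn (selected es A) σ
    u : ℤ
    u = ⟦ not (cut σ e) ⟧
    term : Vec Bool _ → ℤ
    term A = weight (card A) (card B) * ⟦ c A ⟧
    S : ℤ
    S = sumSubsetsOf B term
    neg-out : ∀ x y → (- x) * y ≡ - + 1 * (x * y)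
    neg-out = solve-∀
    swap : ∀ x y z → (+ 2 * x) * (y * z) ≡ (+ 2 * y) * (x * z)
    swap = solve-∀

open InclusionExclusion

-- Even subgraphs via characters: averaging the product of edge signs over
-- all colourings detects whether every degree is even.
module EvenSubgraphs where
  open ≡-Reasoning

  xorL : ∀ {X : Set} → (X → Bool) → List X → Bool
  xorL p = foldr (λ x b → p x xor b) false

  xorFin : (N : ℕ) → (Fin N → Bool) → Bool
  xorFin zero    p = false
  xorFin (suc N) p = p zero xor xorFin N (λ v → p (suc v))

  xorFin-cong : ∀ N {p q : Fin N → Bool} → (∀ v → p v ≡ q v) → xorFin N p ≡ xorFin N q
  xorFin-cong zero    p≗q = refl
  xorFin-cong (suc N) p≗q = cong₂ _xor_ (p≗q zero) (xorFin-cong N (λ v → p≗q (suc v)))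

  xorFin-false : ∀ N → xorFin N (λ _ → false) ≡ false
  xorFin-false zero    = refl
  xorFin-false (suc N) = xorFin-false N

  xorFin-xor : ∀ N (p q : Fin N → Bool) → xorFin N (λ v → p v xor q v) ≡ xorFin N p xor xorFin N q
  xorFin-xor zero    p q = refl
  xorFin-xor (suc N) p q =
    trans (cong ((p zero xor q zero) xor_) (xorFin-xor N (λ v → p (suc v)) (λ v → q (suc v))))
          (xor-interchange (p zero) (q zero) _ _)

  ==-suc : ∀ {N} (a v : Fin N) → (Fin.suc a == Fin.suc v) ≡ (a == v)
  ==-suc a v = bool-ext (λ eq → cong-== (FinP.suc-injective (==-sound eq)))
                        (λ eq → cong-== (cong suc (==-sound eq)))
    where
    cong-== : ∀ {N} {a b : Fin N} → a ≡ b → (a == b) ≡ true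
    cong-== {b = b} refl = ==-refl b

  xorFin-pick : ∀ N (f : Fin N → Bool) a → xorFin N (λ v → f v ∧ (a == v)) ≡ f a
  xorFin-pick (suc N) f zero = begin
    (f zero ∧ true) xor xorFin N (λ v → f (suc v) ∧ false)
      ≡⟨ cong₂ _xor_ (BoolP.∧-identityʳ (f zero))
                     (trans (xorFin-cong N (λ v → BoolP.∧-zeroʳ (f (suc v)))) (xorFin-false N)) ⟩
    f zero xor false ≡⟨ BoolP.xor-identityʳ (f zero) ⟩
    f zero ∎
  xorFin-pick (suc N) f (suc a) = begin
    (f zero ∧ false) xor xorFin N (λ v → f (suc v) ∧ (suc a == suc v))
      ≡⟨ cong₂ _xor_ (BoolP.∧-zeroʳ (f zero)) (xorFin-cong N (λ v → cong (f (suc v) ∧_) (==-suc a v))) ⟩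
    xorFin N (λ v → f (suc v) ∧ (a == v)) ≡⟨ xorFin-pick N (λ v → f (suc v)) a ⟩
    f (suc a) ∎

  oddDegree : ∀ {N} → Edges N → Fin N → Bool
  oddDegree S v = xorL (λ e → (proj₁ e == v) ∨ (proj₂ e == v)) S

  cut-parity : ∀ {N} (σ : Vec Bool N) (S : Edges N) → (∀ {e} → e ∈ S → proj₁ e ≢ proj₂ e) →
    xorL (cut σ) S ≡ xorFin N (λ v → lookup σ v ∧ oddDegree S v)
  cut-parity {N} σ [] loopless =
    sym (trans (xorFin-cong N (λ v → BoolP.∧-zeroʳ (lookup σ v))) (xorFin-false N))
  cut-parity {N} σ ((a , b) ∷ S) loopless = begin
    (c a xor c b) xor xorL (cut σ) S
      ≡⟨ cong ((c a xor c b) xor_) (cut-parity σ S (λ e∈S → loopless (there e∈S))) ⟩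
    (c a xor c b) xor xorFin N (λ v → c v ∧ oddDegree S v)
      ≡⟨ cong₂ (λ p q → (p xor q) xor xorFin N (λ v → c v ∧ oddDegree S v))
               (sym (xorFin-pick N c a)) (sym (xorFin-pick N c b)) ⟩
    (xorFin N (λ v → c v ∧ (a == v)) xor xorFin N (λ v → c v ∧ (b == v)))
      xor xorFin N (λ v → c v ∧ oddDegree S v)
      ≡⟨ sym (trans (xorFin-xor N _ _) (cong (_xor xorFin N (λ v → c v ∧ oddDegree S v)) (xorFin-xor N _ _))) ⟩
    xorFin N (λ v → ((c v ∧ (a == v)) xor (c v ∧ (b == v))) xor (c v ∧ oddDegree S v))
      ≡⟨ xorFin-cong N (λ v → trans (distrib (c v) (a == v) (b == v) (oddDegree S v))
                                    (cong (λ z → c v ∧ (z xor oddDegree S v)) (sym (∨≡xor v)))) ⟩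
    xorFin N (λ v → c v ∧ (((a == v) ∨ (b == v)) xor oddDegree S v)) ∎
    where
    c : Fin N → Bool
    c = lookup σ
    distrib : ∀ s p q r → ((s ∧ p) xor (s ∧ q)) xor (s ∧ r) ≡ s ∧ ((p xor q) xor r)
    distrib false p q r = refl
    distrib true  p q r = refl
    -- a ≠ b, so no vertex is both ends of the edge.
    ∨≡xor : ∀ v → ((a == v) ∨ (b == v)) ≡ ((a == v) xor (b == v))
    ∨≡xor v with a == v in a=v | b == v in b=v
    ... | true  | true  = ⊥-elim (loopless (here refl) (trans (==-sound a=v) (sym (==-sound b=v))))
    ... | true  | false = refl
    ... | false | _     = refl

  sign-xor : ∀ a b → sign (a xor b) ≡ sign a * sign b
  sign-xor false b     = sym (ℤP.*-identityˡ (sign b))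
  sign-xor true  false = refl
  sign-xor true  true  = refl

  cutProduct≡sign : ∀ {N} (σ : Vec Bool N) S → cutProduct σ S ≡ sign (xorL (cut σ) S)
  cutProduct≡sign σ []      = refl
  cutProduct≡sign σ (e ∷ S) =
    trans (cong (sign (cut σ e) *_) (cutProduct≡sign σ S)) (sym (sign-xor (cut σ e) _))

  character-sum : ∀ N (q : Fin N → Bool) →
    sumSubsets N (λ σ → sign (xorFin N (λ v → lookup σ v ∧ q v))) ≡ + (2 ^ N) * ⟦ andFin N (λ v → not (q v)) ⟧
  character-sum zero    q = refl
  character-sum (suc N) q = begin
    T + sumSubsets N (λ σ → sign (q zero xor xorFin N (λ v → lookup σ v ∧ q (suc v))))
      ≡⟨ cong (_+_ T) (trans (sumSubsets-cong N (λ σ → sign-xor (q zero) _))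
                             (sumSubsets-scale N (sign (q zero)) _)) ⟩
    T + sign (q zero) * T
      ≡⟨ cong (λ y → y + sign (q zero) * y) (character-sum N (λ v → q (suc v))) ⟩
    + (2 ^ N) * I + sign (q zero) * (+ (2 ^ N) * I)
      ≡⟨ combine (q zero) ⟩
    + (2 ^ suc N) * ⟦ not (q zero) ∧ andFin N (λ v → not (q (suc v))) ⟧ ∎
    where
    T : ℤ
    T = sumSubsets N (λ σ → sign (xorFin N (λ v → lookup σ v ∧ q (suc v))))
    I : ℤ
    I = ⟦ andFin N (λ v → not (q (suc v))) ⟧
    cancel : ∀ x → x + - + 1 * x ≡ + 0
    cancel = solve-∀
    double : ∀ x y → x * y + + 1 * (x * y) ≡ (+ 2 * x) * y
    double = solve-∀
    combine : ∀ b → + (2 ^ N) * I + sign b * (+ (2 ^ N) * I)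
                    ≡ + (2 ^ suc N) * ⟦ not b ∧ andFin N (λ v → not (q (suc v))) ⟧
    combine true  = trans (cancel (+ (2 ^ N) * I)) (sym (ℤP.*-zeroʳ (+ (2 ^ suc N))))
    combine false = trans (double (+ (2 ^ N)) I) (cong (_* I) (sym (ℤP.pos-* 2 (2 ^ N))))

  isEven-countL : ∀ {X : Set} (p : X → Bool) S → isEven (countL p S) ≡ not (xorL p S)
  isEven-countL p []      = refl
  isEven-countL p (x ∷ S) with p x
  ... | true  = trans (isEven-suc (countL p S)) (cong not (isEven-countL p S))
    where
    isEven-suc : ∀ c → isEven (suc c) ≡ not (isEven c)
    isEven-suc zero          = refl
    isEven-suc (suc zero)    = refl
    isEven-suc (suc (suc c)) = isEven-suc c
  ... | false = isEven-countL p S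

open EvenSubgraphs

module EdgeSubsetExpansions where
  open ≡-Reasoning

  module _ (G : Graph) where

    private
      S : EdgeSubset G → Edges (n G)
      S = selected (edges G)

    selected-loopless : ∀ B {e} → e ∈ S B → proj₁ e ≢ proj₂ e
    selected-loopless = go (edges G) (λ i eq → ℕP.<-irrefl (cong toℕ eq) (noLoopOriented G i))
      where
      go : ∀ {M} (es : Vec (Fin (n G) × Fin (n G)) M) → (∀ i → proj₁ (lookup es i) ≢ proj₂ (lookup es i)) →
           ∀ B {e} → e ∈ selected es B → proj₁ e ≢ proj₂ e
      go []       loopless []          ()
      go (e ∷ es) loopless (true ∷ B)  (here refl) = loopless zero
      go (e ∷ es) loopless (true ∷ B)  (there e∈) = go es (λ i → loopless (suc i)) B e∈
      go (e ∷ es) loopless (false ∷ B) e∈         = go es (λ i → loopless (suc i)) B e∈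

    even-character-sum : ∀ B → sumSubsets (n G) (λ σ → cutProduct σ (S B)) ≡ + (2 ^ n G) * ⟦ allEvenDeg G B ⟧
    even-character-sum B = begin
      sumSubsets N (λ σ → cutProduct σ (S B))
        ≡⟨ sumSubsets-cong N (λ σ → trans (cutProduct≡sign σ (S B))
                                          (cong sign (cut-parity σ (S B) (selected-loopless B)))) ⟩
      sumSubsets N (λ σ → sign (xorFin N (λ v → lookup σ v ∧ oddDegree (S B) v)))
        ≡⟨ character-sum N (oddDegree (S B)) ⟩
      + (2 ^ N) * ⟦ andFin N (λ v → not (oddDegree (S B) v)) ⟧
        ≡⟨ cong (λ b → + (2 ^ N) * ⟦ b ⟧)
                (sym (trans (allL-allFin N (λ v → isEven (degree G B v)))
                            (andFin-cong N (λ v → isEven-countL _ (S B))))) ⟩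
      + (2 ^ N) * ⟦ allEvenDeg G B ⟧ ∎
      where
      N : ℕ
      N = n G

    colouring-sum : ∀ B → sumSubsets (n G) (λ σ → cutProduct σ (S B))
                        ≡ sumSubsetsOf B (λ A → weight (card A) (card B) * + (2 ^ k G A))
    colouring-sum B = begin
      sumSubsets N (λ σ → cutProduct σ (S B))
        ≡⟨ sumSubsets-cong N (λ σ → sym (inclusion-exclusion (edges G) B σ)) ⟩
      sumSubsets N (λ σ → sumSubsetsOf B (λ A → weight (card A) (card B) * ⟦ constantOn (S A) σ ⟧))
        ≡⟨ sumSubsets-sumSubsetsOf N B _ ⟩
      sumSubsetsOf B (λ A → sumSubsets N (λ σ → weight (card A) (card B) * ⟦ constantOn (S A) σ ⟧))
        ≡⟨ sumSubsetsOf-cong B (λ A → trans (sumSubsets-scale N (weight (card A) (card B)) _)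
             (cong (weight (card A) (card B) *_)
                   (trans (sumSubsets-⟦⟧ N (constantOn (S A))) (cong +_ (count-constantOn (S A)))))) ⟩
      sumSubsetsOf B (λ A → weight (card A) (card B) * + (2 ^ k G A)) ∎
      where
      N : ℕ
      N = n G

    constantOn-subset : ∀ A σ → constantOn (S (fullSubset (m G))) σ ≡ true → constantOn (S A) σ ≡ true
    constantOn-subset = go (edges G)
      where
      go : ∀ {M} (es : Vec (Fin (n G) × Fin (n G)) M) A σ →
           constantOn (selected es (fullSubset M)) σ ≡ true → constantOn (selected es A) σ ≡ true
      go []       []          σ const = const
      go (e ∷ es) (true ∷ A)  σ const =
        cong₂ _∧_ (BoolP.∧-conicalˡ _ _ const) (go es A σ (BoolP.∧-conicalʳ (not (cut σ e)) _ const))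
      go (e ∷ es) (false ∷ A) σ const = go es A σ (BoolP.∧-conicalʳ (not (cut σ e)) _ const)

    length-selected : ∀ A → length (S A) ≡ card A
    length-selected = go (edges G)
      where
      go : ∀ {M} (es : Vec (Fin (n G) × Fin (n G)) M) A → length (selected es A) ≡ card A
      go []       []          = refl
      go (e ∷ es) (true ∷ A)  = cong suc (go es A)
      go (e ∷ es) (false ∷ A) = go es A

    -- k(E) ≤ k(A) ≤ |V| ≤ k(A) + |A|, so the exponents in the Tutte polynomial are exact.
    kE≤k : ∀ A → kE G ≤ k G A
    kE≤k A = 2^-cancel-≤ _ _ (subst₂ _≤_ (count-constantOn (S (fullSubset (m G))))
                                         (count-constantOn (S A))
                                         (count-mono (n G) (constantOn-subset A)))

    k≤n : ∀ A → k G A ≤ n G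
    k≤n A = components-≤ (S A)

    n≤k+card : ∀ A → n G ≤ k G A ℕ.+ card A
    n≤k+card A = subst (λ c → n G ≤ k G A ℕ.+ c) (length-selected A) (rank-inequality (S A))

    corank nullity : EdgeSubset G → ℕ
    corank  A = k G A ∸ kE G
    nullity A = (k G A ℕ.+ card A) ∸ n G

    tutte-rankExpansion : IsRankExpansion (m G) corank nullity (tutte G)
    tutte-rankExpansion i j = begin
      sumP (map term (allSubsets (m G))) i j
        ≡⟨ sumP-map term (allSubsets (m G)) ⟩
      sumℤ (map (λ A → term A i j) (allSubsets (m G)))
        ≡⟨ sumℤ-map-cong (allSubsets (m G)) (λ A → powCoeff-xy (corank A) (nullity A) i j) ⟩
      sumℤ (map (λ A → powCoeff (corank A) i * powCoeff (nullity A) j) (allSubsets (m G)))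
        ≡⟨ sumSubsets-allSubsets (m G) _ ⟩
      sumSubsets (m G) (λ A → powCoeff (corank A) i * powCoeff (nullity A) j) ∎
      where
      term : EdgeSubset G → Poly2
      term A = (x-1 ^P corank A) *P (y-1 ^P nullity A)
      sumP-map : ∀ {X : Set} (f : X → Poly2) xs → sumP (map f xs) i j ≡ sumℤ (map (λ x → f x i j) xs)
      sumP-map f []       = refl
      sumP-map f (x ∷ xs) = cong (_+_ (f x i j)) (sumP-map f xs)

    euler-coefficient : ∀ d → euler G d ≡ sumSubsets (m G) (λ B → ⟦ allEvenDeg G B ⟧ * ⟦ card B ℕ.≡ᵇ d ⟧)
    euler-coefficient d = begin
      sumP1 (map (λ A → monomial (card A)) (filter (λ A → allEvenDeg G A BoolP.≟ true) Subsets)) d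
        ≡⟨ sumP1-map _ (filter (λ A → allEvenDeg G A BoolP.≟ true) Subsets) ⟩
      sumℤ (map (λ A → monomial (card A) d) (filter (λ A → allEvenDeg G A BoolP.≟ true) Subsets))
        ≡⟨ sumℤ-filter (allEvenDeg G) (λ A → monomial (card A) d) Subsets ⟩
      sumℤ (map (λ A → ⟦ allEvenDeg G A ⟧ * monomial (card A) d) Subsets)
        ≡⟨ sumℤ-map-cong Subsets (λ A → cong (⟦ allEvenDeg G A ⟧ *_) (monomial≡ (card A))) ⟩
      sumℤ (map (λ A → ⟦ allEvenDeg G A ⟧ * ⟦ card A ℕ.≡ᵇ d ⟧) Subsets)
        ≡⟨ sumSubsets-allSubsets (m G) _ ⟩
      sumSubsets (m G) (λ B → ⟦ allEvenDeg G B ⟧ * ⟦ card B ℕ.≡ᵇ d ⟧) ∎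
      where
      Subsets : List (EdgeSubset G)
      Subsets = allSubsets (m G)
      sumP1-map : ∀ {X : Set} (f : X → Poly1) xs → sumP1 (map f xs) d ≡ sumℤ (map (λ x → f x d) xs)
      sumP1-map f []       = refl
      sumP1-map f (x ∷ xs) = cong (_+_ (f x d)) (sumP1-map f xs)
      sumℤ-filter : ∀ {X : Set} (p : X → Bool) (g : X → ℤ) xs →
        sumℤ (map g (filter (λ x → p x BoolP.≟ true) xs)) ≡ sumℤ (map (λ x → ⟦ p x ⟧ * g x) xs)
      sumℤ-filter p g []       = refl
      sumℤ-filter p g (x ∷ xs) with p x
      ... | true  = cong₂ _+_ (sym (ℤP.*-identityˡ (g x))) (sumℤ-filter p g xs)
      ... | false = trans (sumℤ-filter p g xs)
                          (sym (trans (cong (_+ rest) (ℤP.*-zeroˡ (g x))) (ℤP.+-identityˡ rest)))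
        where
        rest : ℤ
        rest = sumℤ (map (λ x → ⟦ p x ⟧ * g x) xs)
      monomial≡ : ∀ a → monomial a d ≡ ⟦ a ℕ.≡ᵇ d ⟧
      monomial≡ a with a ℕ.≡ᵇ d
      ... | true  = refl
      ... | false = refl

  -- The contribution of an edge subset A with k(A) = K and |A| = a to 2^|V| e_d(G):
  --   2^K Σ_{B ⊇ A, |B| = d} (-1)^(|B|-|A|) 2^|A|.
  eulerSummand : ℕ → ℕ → ℕ → ℕ → ℤ
  eulerSummand M d K a = + (2 ^ K) * binomialSum (M ∸ a) (λ j → weight a (a ℕ.+ j) * ⟦ a ℕ.+ j ℕ.≡ᵇ d ⟧)

  euler-via-subsets : ∀ G d →
    + (2 ^ n G) * euler G d ≡ sumSubsets (m G) (λ A → eulerSummand (m G) d (k G A) (card A))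
  euler-via-subsets G d = begin
    + (2 ^ n G) * euler G d
      ≡⟨ cong (+ (2 ^ n G) *_) (euler-coefficient G d) ⟩
    + (2 ^ n G) * sumSubsets M (λ B → ⟦ allEvenDeg G B ⟧ * [d] B)
      ≡⟨ sym (sumSubsets-scale M (+ (2 ^ n G)) _) ⟩
    sumSubsets M (λ B → + (2 ^ n G) * (⟦ allEvenDeg G B ⟧ * [d] B))
      ≡⟨ sumSubsets-cong M (λ B → trans (sym (ℤP.*-assoc (+ (2 ^ n G)) _ ([d] B)))
                                        (cong (_* [d] B) (sym (even-character-sum G B)))) ⟩
    sumSubsets M (λ B → sumSubsets (n G) (λ σ → cutProduct σ (selected (edges G) B)) * [d] B)
      ≡⟨ sumSubsets-cong M (λ B → trans (cong (_* [d] B) (colouring-sum G B)) (move-in B)) ⟩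
    sumSubsets M (λ B → sumSubsetsOf B (λ A → g A B))
      ≡⟨ sum-subsets-supersets M g ⟩
    sumSubsets M (λ A → sumSupersetsOf A (λ B → g A B))
      ≡⟨ sumSubsets-cong M (λ A →
           trans (sumSupersetsOf-cong A (λ B → ℤP.*-comm (weight (card A) (card B) * [d] B) _))
                 (sumSupersetsOf-scale A (+ (2 ^ k G A)) _)) ⟩
    sumSubsets M (λ A → + (2 ^ k G A) * sumSupersetsOf A (λ B → weight (card A) (card B) * [d] B))
      ≡⟨ sumSubsets-cong M (λ A → cong (+ (2 ^ k G A) *_)
                                       (sumSupersetsOf-card A (λ b → weight (card A) b * ⟦ b ℕ.≡ᵇ d ⟧))) ⟩
    sumSubsets M (λ A → eulerSummand M d (k G A) (card A)) ∎
    where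
    M : ℕ
    M = m G
    [d] : EdgeSubset G → ℤ
    [d] B = ⟦ card B ℕ.≡ᵇ d ⟧
    g : EdgeSubset G → EdgeSubset G → ℤ
    g A B = (weight (card A) (card B) * [d] B) * + (2 ^ k G A)
    regroup : ∀ x y z → x * (y * z) ≡ (y * x) * z
    regroup = solve-∀
    move-in : ∀ B → sumSubsetsOf B (λ A → weight (card A) (card B) * + (2 ^ k G A)) * [d] B
                  ≡ sumSubsetsOf B (λ A → g A B)
    move-in B = begin
      sumSubsetsOf B (λ A → weight (card A) (card B) * + (2 ^ k G A)) * [d] B
        ≡⟨ ℤP.*-comm _ ([d] B) ⟩
      [d] B * sumSubsetsOf B (λ A → weight (card A) (card B) * + (2 ^ k G A))
        ≡⟨ sym (sumSubsetsOf-scale B ([d] B) _) ⟩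
      sumSubsetsOf B (λ A → [d] B * (weight (card A) (card B) * + (2 ^ k G A)))
        ≡⟨ sumSubsetsOf-cong B (λ A → regroup ([d] B) (weight (card A) (card B)) (+ (2 ^ k G A))) ⟩
      sumSubsetsOf B (λ A → g A B) ∎

open EdgeSubsetExpansions

module EulerFromTutte where
  open ≡-Reasoning

  Shape : Set
  Shape = ℕ × ℕ × ℕ

  shape : Graph → Shape
  shape G = n G , m G , kE G

  similar⇒same-shape : ∀ G H → Similar G H → shape G ≡ shape H
  similar⇒same-shape G H (n≡ , m≡ , kE≡) = cong₂ _,_ n≡ (cong₂ _,_ m≡ kE≡)

  -- Since k(A) = ρ(A) + k(E) and |A| = ν(A) + |V| - k(A), the summand of
  -- euler-via-subsets is a function of (ρ(A), ν(A)) and the shape of G,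
  -- so the sum can be read off from the Tutte polynomial.
  summandByRanks : Shape → ℕ → ℕ → ℕ → ℤ
  summandByRanks (N , M , K) d ρ ν = eulerSummand M d (ρ ℕ.+ K) ((ν ℕ.+ N) ∸ (ρ ℕ.+ K))

  eulerFromTutte : Shape → ℕ → Poly2 → ℤ
  eulerFromTutte (N , M , K) d = tutteTransform (suc (N ℕ.+ M)) (summandByRanks (N , M , K) d)

  eulerFromTutte-cong : ∀ sh d {T T′} → T ≈P2 T′ → eulerFromTutte sh d T ≡ eulerFromTutte sh d T′
  eulerFromTutte-cong (N , M , K) d = tutteTransform-cong (suc (N ℕ.+ M)) (summandByRanks (N , M , K) d)

  euler-via-tutte : ∀ G d → + (2 ^ n G) * euler G d ≡ eulerFromTutte (shape G) d (tutte G)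
  euler-via-tutte G d = begin
    + (2 ^ n G) * euler G d
      ≡⟨ euler-via-subsets G d ⟩
    sumSubsets (m G) (λ A → eulerSummand (m G) d (k G A) (card A))
      ≡⟨ sumSubsets-cong (m G) (λ A → cong₂ (eulerSummand (m G) d) (sym (k≡ A)) (sym (card≡ A))) ⟩
    sumSubsets (m G) (λ A → summandByRanks (shape G) d (corank G A) (nullity G A))
      ≡⟨ sym (RankRecovery.tutteTransform-sums (m G) (corank G) (nullity G) D corank<D nullity<D
                                               (tutte-rankExpansion G) (summandByRanks (shape G) d)) ⟩
    eulerFromTutte (shape G) d (tutte G) ∎
    where
    D : ℕ
    D = suc (n G ℕ.+ m G)
    k≡ : ∀ A → corank G A ℕ.+ kE G ≡ k G A
    k≡ A = ℕP.m∸n+n≡m (kE≤k G A)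
    card≡ : ∀ A → (nullity G A ℕ.+ n G) ∸ (corank G A ℕ.+ kE G) ≡ card A
    card≡ A = trans (cong₂ _∸_ (ℕP.m∸n+n≡m (n≤k+card G A)) (k≡ A)) (ℕP.m+n∸m≡n (k G A) (card A))
    corank<D : ∀ A → corank G A < D
    corank<D A =
      s≤s (ℕP.≤-trans (ℕP.m∸n≤m (k G A) (kE G)) (ℕP.≤-trans (k≤n G A) (ℕP.m≤m+n (n G) (m G))))
    nullity<D : ∀ A → nullity G A < D
    nullity<D A = s≤s (ℕP.≤-trans (ℕP.m∸n≤m _ (n G)) (ℕP.+-mono-≤ (k≤n G A) (card-≤ A)))

  cancel-2^ : ∀ N {x y} → + (2 ^ N) * x ≡ + (2 ^ N) * y → x ≡ y
  cancel-2^ N {x} {y} = ℤP.*-cancelˡ-≡ (+ (2 ^ N)) x y {{ℕP.m^n≢0 2 N}}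

open EulerFromTutte

proposition7p12 : (G H : Graph) → Similar G H → tutte G ≈P2 tutte H → euler G ≈P1 euler H
proposition7p12 G H similar tutteG≈tutteH d = cancel-2^ (n G) (begin
  + (2 ^ n G) * euler G d
    ≡⟨ euler-via-tutte G d ⟩
  eulerFromTutte (shape G) d (tutte G)
    ≡⟨ eulerFromTutte-cong (shape G) d tutteG≈tutteH ⟩
  eulerFromTutte (shape G) d (tutte H)
    ≡⟨ cong (λ sh → eulerFromTutte sh d (tutte H)) (similar⇒same-shape G H similar) ⟩
  eulerFromTutte (shape H) d (tutte H)
    ≡⟨ euler-via-tutte H d ⟨
  + (2 ^ n H) * euler H d
    ≡⟨ cong (λ N → + (2 ^ N) * euler H d) (proj₁ similar) ⟨
  + (2 ^ n G) * euler H d ∎)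
  where open ≡-Reasoning
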